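{- For any finite directed graph $G$, the rational function $N(G)$ is a polynomial in the variables $x_v$, $v\in V_G$. Moreover, if $G$ is disconnected, then $N(G)=0$.
   Context: A graph $G$ consists of a finite vertex set $V_G$ and an edge set $E_G\subset V_G\times V_G$; for $e=(u,v)$ write $\alpha(e)=u$, $\omega(e)=v$. A linear extension of $G$ is a total order on $V_G$ with $\alpha(e)$ before $\omega(e)$ for every $e\in E_G$, written as the word $w=w_1\cdots w_n$ listing the vertices in increasing order; $\mathcal L(G)$ is their set. $\Psi(G)=\sum_{w\in\mathcal L(G)}\prod_{i=1}^{n-1}(x_{w_i}-x_{w_{i+1}})^{ -1}$ and $N(G)=\Psi(G)\prod_{e\in E_G}(x_{\alpha(e)}-x_{\omega(e)})$. Connectedness refers to the underlying undirected graph. -}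

module Defs where

open import Data.Nat using (ℕ)
open import Data.Bool using (Bool; true; false; _∧_; not)
open import Data.Fin using (Fin)
open import Data.List using (List; []; _∷_; _++_; map; concatMap; foldr; allFin)
open import Data.Rational using (ℚ; 0ℚ; 1ℚ; _+_; _*_; _-_; 1/_; ≢-nonZero)
open import Data.Rational.Properties using (_≟_)
open import Relation.Nullary using (yes; no)
open import Relation.Binary.PropositionalEquality using (_≡_)

record Graph (n : ℕ) : Set where
  field
    edge : Fin n → Fin n → Bool
open Graph public

data Reach {n : ℕ} (G : Graph n) : Fin n → Fin n → Set where
  here : ∀ {u} → Reach G u u
  fwd  : ∀ {u v w} → edge G u v ≡ true → Reach G v w → Reach G u w
  bwd  : ∀ {u v w} → edge G v u ≡ true → Reach G v w → Reach G u w

Connected : ∀ {n} → Graph n → Set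
Connected G = ∀ u v → Reach G u v

insertions : ∀ {A : Set} → A → List A → List (List A)
insertions x []       = (x ∷ []) ∷ []
insertions x (y ∷ ys) = (x ∷ y ∷ ys) ∷ map (y ∷_) (insertions x ys)

permutations : ∀ {A : Set} → List A → List (List A)
permutations []       = [] ∷ []
permutations (x ∷ xs) = concatMap (insertions x) (permutations xs)

allB : ∀ {A : Set} → (A → Bool) → List A → Bool
allB p []       = true
allB p (x ∷ xs) = p x ∧ allB p xs

-- A word w (listing the vertices in increasing order) respects G iff for
-- every edge e, α(e) comes strictly before ω(e): i.e. no letter a has an
-- edge (b , a) with b = a or b occurring after a.
respects : ∀ {n} → Graph n → List (Fin n) → Bool
respects G []       = true
respects G (a ∷ ws) = not (edge G a a) ∧ allB (λ b → not (edge G b a)) ws ∧ respects G ws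

linExts : ∀ {n} → Graph n → List (List (Fin n))
linExts {n} G = filterB (respects G) (permutations (allFin n))
  where
  filterB : ∀ {A : Set} → (A → Bool) → List A → List A
  filterB p []       = []
  filterB p (x ∷ xs) with p x
  ... | true  = x ∷ filterB p xs
  ... | false = filterB p xs

-- total inverse (only ever applied to nonzero values when x is injective)
inv : ℚ → ℚ
inv q with q ≟ 0ℚ
... | yes _  = 0ℚ
... | no q≢0 = 1/_ q {{≢-nonZero q≢0}}

sumℚ : List ℚ → ℚ
sumℚ = foldr _+_ 0ℚ

prodℚ : List ℚ → ℚ
prodℚ = foldr _*_ 1ℚ

wordTerm : ∀ {n} → (Fin n → ℚ) → List (Fin n) → ℚ
wordTerm x []               = 1ℚ
wordTerm x (a ∷ [])         = 1ℚ
wordTerm x (a ∷ b ∷ ws)     = inv (x a - x b) * wordTerm x (b ∷ ws)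

Ψ : ∀ {n} → Graph n → (Fin n → ℚ) → ℚ
Ψ G x = sumℚ (map (wordTerm x) (linExts G))

edgeProd : ∀ {n} → Graph n → (Fin n → ℚ) → ℚ
edgeProd {n} G x =
  prodℚ (concatMap (λ u → concatMap (λ v → factor u v (edge G u v)) (allFin n)) (allFin n))
  where
  factor : Fin n → Fin n → Bool → List ℚ
  factor u v true  = (x u - x v) ∷ []
  factor u v false = []

N : ∀ {n} → Graph n → (Fin n → ℚ) → ℚ
N G x = Ψ G x * edgeProd G x

data Poly (n : ℕ) : Set where
  con  : ℚ → Poly n
  var  : Fin n → Poly n
  _⊕_  : Poly n → Poly n → Poly n
  _⊗_  : Poly n → Poly n → Poly n

eval : ∀ {n} → Poly n → (Fin n → ℚ) → ℚ
eval (con c) x = c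
eval (var v) x = x v
eval (p ⊕ q) x = eval p x + eval q x
eval (p ⊗ q) x = eval p x * eval q x

-- Write N(G) = Ψ(G) · E(G), where E(G) is the product of x_α(e) - x_ω(e) over the arcs and
-- Ψ(G) = ∑_w 𝟙[w respects G] · wordTerm x w over all orderings w of the vertices, and induct on the
-- number of arcs. A loop makes Ψ(G) = 0. If an arc a → b lies on an undirected cycle, let S consist
-- of a → b and the other arcs of the cycle pointing the same way round it. Reversing all of S would
-- make the cycle directed, so the alternating sum of Ψ(G ∖ T) over T ⊆ S vanishes, and N(G) is a
-- combination, with polynomial coefficients, of the N(G ∖ T) for T ≠ ∅; these have fewer arcs and
-- are disconnected whenever G is. Otherwise G is a forest, and N(G) is 1 or 0 according to whether
-- G is connected. This goes by induction on the number of vertices and the degree of vertex 0: an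
-- arc into 0 can be reversed at the cost of N of a disconnected forest; two arcs 0 → p and 0 → q
-- can be traded for an arc between p and q, as 𝟙[0<p] 𝟙[0<q] = 𝟙[0<p] 𝟙[p<q] + 𝟙[0<q] 𝟙[q<p];
-- a leaf 0 → u can be removed, as the orderings that insert 0 before u contribute exactly
-- 1/(x_0 - x_u); and an isolated vertex makes Ψ vanish, as inserting a letter at every position
-- of a word gives terms summing to 0.

module Submission where

open import Defs
open import Data.Bool using (Bool; true; false; _∧_; _∨_; not; if_then_else_)
import Data.Bool.Properties as Boolₚ
open import Data.Bool.Properties using (∧-zeroʳ; ∧-identityʳ; ∨-zeroʳ; ∨-identityʳ; ∨-comm; ∧-commutativeMonoid)
open import Algebra.Bundles using (CommutativeMonoid)
open import Algebra.Properties.CommutativeSemigroup (CommutativeMonoid.commutativeSemigroup ∧-commutativeMonoid)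
  using () renaming (interchange to ∧-interchange)
open import Data.Empty using (⊥; ⊥-elim)
open import Data.Fin using (Fin; zero; suc)
open import Data.Fin.Properties as Finₚ using (suc-injective)
open import Data.List using (List; []; _∷_; _++_; map; concatMap; allFin; tabulate)
open import Data.List.Properties as Listₚ using (concatMap-cong)
open import Data.List.Membership.Propositional using (_∈_; _∉_; find)
open import Data.List.Membership.Propositional.Properties using (∈-map⁺; ∈-map⁻; ∈-allFin; ∈-concatMap⁻)
open import Data.List.Relation.Unary.Any using (here; there; any?)
open import Data.List.Relation.Binary.Permutation.Propositional
  using (_↭_; ↭-refl; ↭-prep; ↭-swap; ↭-trans; ↭-sym; ↭⇒↭ₛ)
open import Data.List.Relation.Binary.Permutation.Propositional.Properties using (∈-resp-↭)
open import Data.List.Relation.Binary.Permutation.Setoid.Properties using (Unique-resp-↭)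
open import Data.List.Relation.Unary.All as All using (All; []; _∷_)
open import Data.List.Relation.Unary.All.Properties using (¬Any⇒All¬; All¬⇒¬Any)
open import Data.List.Relation.Unary.Unique.Propositional using (Unique; []; _∷_)
open import Data.List.Relation.Unary.Unique.Propositional.Properties as Uniqueₚ
  using (allFin⁺; Unique[x∷xs]⇒x∉xs)
open import Data.Nat as ℕ using (ℕ; zero; suc; _<_; _≤_; s≤s; z≤n)
open import Data.Nat.Induction using (<-wellFounded)
import Data.Nat.Tactic.RingSolver as ℕ-Solver
open import Data.Nat.Properties as ℕₚ using (<-asym; <-irrefl)
open import Data.Product using (Σ; _×_; _,_; proj₁; proj₂; ∃; ∃-syntax)
open import Data.Product.Properties using (≡-dec)
open import Data.Rational using (ℚ; 0ℚ; 1ℚ; _+_; _*_; _-_; -_; ≢-nonZero)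
open import Data.Rational.Solver using (module +-*-Solver)
open import Data.Rational.Properties
  using (_≟_; 1≢0; +-identityˡ; +-inverseʳ; +-assoc; *-identityˡ; *-identityʳ; *-zeroˡ; *-zeroʳ; *-assoc; *-inverseʳ;
         *-distribˡ-+; *-distribʳ-+)
open import Data.Sum using (_⊎_; inj₁; inj₂)
open import Function using (_∘_; _⇔_; mk⇔; Equivalence)
open import Function.Definitions using (Injective)
import Induction.WellFounded as WF
open import Level using (0ℓ)
open import Relation.Binary.Construct.On as On using ()
open import Relation.Binary.PropositionalEquality
open import Relation.Nullary using (¬_; Dec; yes; no; does)
open import Relation.Nullary.Decidable using (dec-true; dec-false; ¬?; _×-dec_)
open +-*-Solver using (solve; _:=_; con; _:+_; _:*_; _:-_; :-_)

𝟙 : Bool → ℚ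
𝟙 true  = 1ℚ
𝟙 false = 0ℚ

𝟙-∧ : ∀ a b → 𝟙 (a ∧ b) ≡ 𝟙 a * 𝟙 b
𝟙-∧ true  b = sym (*-identityˡ (𝟙 b))
𝟙-∧ false b = sym (*-zeroˡ (𝟙 b))

p-q≡0⇒p≡q : ∀ p q → p - q ≡ 0ℚ → p ≡ q
p-q≡0⇒p≡q p q p-q≡0 = begin
  p             ≡⟨ p≡[p-q]+q p q ⟩
  (p - q) + q   ≡⟨ cong (_+ q) p-q≡0 ⟩
  0ℚ + q        ≡⟨ +-identityˡ q ⟩
  q             ∎
  where
  open ≡-Reasoning
  p≡[p-q]+q : ∀ p q → p ≡ (p - q) + q
  p≡[p-q]+q = solve 2 (λ p q → p := (p :- q) :+ q) refl

p≢q⇒p-q≢0 : ∀ {p q} → p ≢ q → p - q ≢ 0ℚ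
p≢q⇒p-q≢0 {p} {q} p≢q = p≢q ∘ p-q≡0⇒p≡q p q

*-inv : ∀ q → q ≢ 0ℚ → q * inv q ≡ 1ℚ
*-inv q q≢0 with q ≟ 0ℚ
... | yes q≡0 = ⊥-elim (q≢0 q≡0)
... | no  q≢0 = *-inverseʳ q {{≢-nonZero q≢0}}

inv-unique : ∀ q r → q * r ≡ 1ℚ → inv q ≡ r
inv-unique q r qr≡1 = begin
  inv q                ≡⟨ i≡i*1 (inv q) ⟩
  inv q * 1ℚ           ≡⟨ cong (inv q *_) (sym qr≡1) ⟩
  inv q * (q * r)      ≡⟨ reassoc (inv q) q r ⟩
  (q * inv q) * r      ≡⟨ cong (_* r) (*-inv q q≢0) ⟩
  1ℚ * r               ≡⟨ *-identityˡ r ⟩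
  r                    ∎
  where
  open ≡-Reasoning
  q≢0 : q ≢ 0ℚ
  q≢0 refl = 1≢0 (trans (sym qr≡1) (*-zeroˡ r))
  i≡i*1 : ∀ i → i ≡ i * 1ℚ
  i≡i*1 = solve 1 (λ i → i := i :* con 1ℚ) refl
  reassoc : ∀ i q r → i * (q * r) ≡ (q * i) * r
  reassoc = solve 3 (λ i q r → i :* (q :* r) := (q :* i) :* r) refl

inv-neg : ∀ q → inv (- q) ≡ - inv q
inv-neg q = by-cases (q ≟ 0ℚ)
  where
  by-cases : Dec (q ≡ 0ℚ) → inv (- q) ≡ - inv q
  by-cases (yes refl) = refl
  by-cases (no q≢0)   = inv-unique (- q) (- inv q) (trans (neg*neg q (inv q)) (*-inv q q≢0))
    where
    neg*neg : ∀ p q → (- p) * (- q) ≡ p * q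
    neg*neg = solve 2 (λ p q → (:- p) :* (:- q) := p :* q) refl

inv-diff-antisym : ∀ a b → inv (a - b) + inv (b - a) ≡ 0ℚ
inv-diff-antisym a b = begin
  inv (a - b) + inv (b - a)          ≡⟨ cong (λ d → inv (a - b) + inv d) (b-a≡-[a-b] a b) ⟩
  inv (a - b) + inv (- (a - b))      ≡⟨ cong (inv (a - b) +_) (inv-neg (a - b)) ⟩
  inv (a - b) + - inv (a - b)        ≡⟨ +-inverseʳ (inv (a - b)) ⟩
  0ℚ                                 ∎
  where
  open ≡-Reasoning
  b-a≡-[a-b] : ∀ a b → b - a ≡ - (a - b)
  b-a≡-[a-b] = solve 2 (λ a b → b :- a := :- (a :- b)) refl

partial-fractions : ∀ A B → A ≢ 0ℚ → B ≢ 0ℚ → A + B ≢ 0ℚ →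
                    inv A * inv B ≡ inv (A + B) * (inv A + inv B)
partial-fractions A B A≢0 B≢0 A+B≢0 = begin
  inv A * inv B
    ≡⟨ *-identityˡ _ ⟨
  1ℚ * (inv A * inv B)
    ≡⟨ cong (_* (inv A * inv B)) (*-inv (A + B) A+B≢0) ⟨
  ((A + B) * inv (A + B)) * (inv A * inv B)
    ≡⟨ regroup A B (inv A) (inv B) (inv (A + B)) ⟩
  inv (A + B) * ((A * inv A) * inv B + (B * inv B) * inv A)
    ≡⟨ cong₂ (λ s t → inv (A + B) * (s * inv B + t * inv A)) (*-inv A A≢0) (*-inv B B≢0) ⟩
  inv (A + B) * (1ℚ * inv B + 1ℚ * inv A)
    ≡⟨ drop-ones (inv A) (inv B) (inv (A + B)) ⟩
  inv (A + B) * (inv A + inv B) ∎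
  where
  open ≡-Reasoning
  regroup : ∀ A B a b c → ((A + B) * c) * (a * b) ≡ c * ((A * a) * b + (B * b) * a)
  regroup = solve 5 (λ A B a b c → ((A :+ B) :* c) :* (a :* b) := c :* ((A :* a) :* b :+ (B :* b) :* a)) refl
  drop-ones : ∀ a b c → c * (1ℚ * b + 1ℚ * a) ≡ c * (a + b)
  drop-ones = solve 3 (λ a b c → c :* (con 1ℚ :* b :+ con 1ℚ :* a) := c :* (a :+ b)) refl

inv-diff-chain : ∀ {a b c} → a ≢ b → b ≢ c → a ≢ c →
                 inv (a - b) * inv (b - c) ≡ inv (a - c) * (inv (a - b) + inv (b - c))
inv-diff-chain {a} {b} {c} a≢b b≢c a≢c = begin
  inv (a - b) * inv (b - c)
    ≡⟨ partial-fractions (a - b) (b - c) (p≢q⇒p-q≢0 a≢b) (p≢q⇒p-q≢0 b≢c)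
                         (p≢q⇒p-q≢0 a≢c ∘ trans (sym telescope)) ⟩
  inv ((a - b) + (b - c)) * (inv (a - b) + inv (b - c))
    ≡⟨ cong (λ d → inv d * (inv (a - b) + inv (b - c))) telescope ⟩
  inv (a - c) * (inv (a - b) + inv (b - c)) ∎
  where
  open ≡-Reasoning
  telescope : (a - b) + (b - c) ≡ a - c
  telescope = lemma a b c
    where
    lemma : ∀ a b c → (a - b) + (b - c) ≡ a - c
    lemma = solve 3 (λ a b c → (a :- b) :+ (b :- c) := a :- c) refl

*-cancelˡ : ∀ {d} a b → d ≢ 0ℚ → d * a ≡ d * b → a ≡ b
*-cancelˡ {d} a b d≢0 da≡db = begin
  a                    ≡⟨ *-identityˡ a ⟨
  1ℚ * a               ≡⟨ cong (_* a) (*-inv d d≢0) ⟨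
  (d * inv d) * a      ≡⟨ reassoc d (inv d) a ⟩
  inv d * (d * a)      ≡⟨ cong (inv d *_) da≡db ⟩
  inv d * (d * b)      ≡⟨ reassoc d (inv d) b ⟨
  (d * inv d) * b      ≡⟨ cong (_* b) (*-inv d d≢0) ⟩
  1ℚ * b               ≡⟨ *-identityˡ b ⟩
  b                    ∎
  where
  open ≡-Reasoning
  reassoc : ∀ d i a → (d * i) * a ≡ i * (d * a)
  reassoc = solve 3 (λ d i a → (d :* i) :* a := i :* (d :* a)) refl

true≢false : true ≢ false
true≢false ()

∧-true⁻ : ∀ a {b} → a ∧ b ≡ true → a ≡ true × b ≡ true
∧-true⁻ true b≡true = refl , b≡true

∨-true⁻ : ∀ a {b} → a ∨ b ≡ true → a ≡ true ⊎ b ≡ true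
∨-true⁻ true  _      = inj₁ refl
∨-true⁻ false b≡true = inj₂ b≡true

not-true⁻ : ∀ {b} → not b ≡ true → b ≡ false
not-true⁻ {false} _ = refl

not-false⁻ : ∀ {b} → not b ≡ false → b ≡ true
not-false⁻ {true} _ = refl

≢true⇒≡false : ∀ {b} → b ≢ true → b ≡ false
≢true⇒≡false {false} _   = refl
≢true⇒≡false {true}  b≢t = ⊥-elim (b≢t refl)

∑ : ∀ {A : Set} → List A → (A → ℚ) → ℚ
∑ xs f = sumℚ (map f xs)

infix 5 ∑
syntax ∑ xs (λ a → e) = ∑[ a ← xs ] e

module _ {A : Set} where

  ∑-cong : ∀ {xs : List A} {f g : A → ℚ} → (∀ {a} → a ∈ xs → f a ≡ g a) → ∑ xs f ≡ ∑ xs g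
  ∑-cong {[]}     f≗g = refl
  ∑-cong {a ∷ xs} f≗g = cong₂ _+_ (f≗g (here refl)) (∑-cong (f≗g ∘ there))

  ∑-zero : ∀ {xs : List A} {f : A → ℚ} → (∀ {a} → a ∈ xs → f a ≡ 0ℚ) → ∑ xs f ≡ 0ℚ
  ∑-zero {[]}     f≗0 = refl
  ∑-zero {a ∷ xs} f≗0 = trans (cong₂ _+_ (f≗0 (here refl)) (∑-zero (f≗0 ∘ there))) (+-identityˡ 0ℚ)

  ∑-+ : ∀ (xs : List A) (f g : A → ℚ) → ∑[ a ← xs ] (f a + g a) ≡ ∑ xs f + ∑ xs g
  ∑-+ []       f g = refl
  ∑-+ (a ∷ xs) f g = trans (cong (f a + g a +_) (∑-+ xs f g)) (interchange (f a) (g a) (∑ xs f) (∑ xs g))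
    where
    interchange : ∀ x y s t → (x + y) + (s + t) ≡ (x + s) + (y + t)
    interchange = solve 4 (λ x y s t → (x :+ y) :+ (s :+ t) := (x :+ s) :+ (y :+ t)) refl

  ∑-- : ∀ (xs : List A) (f g : A → ℚ) → ∑[ a ← xs ] (f a - g a) ≡ ∑ xs f - ∑ xs g
  ∑-- []       f g = refl
  ∑-- (a ∷ xs) f g = trans (cong (f a - g a +_) (∑-- xs f g)) (interchange (f a) (g a) (∑ xs f) (∑ xs g))
    where
    interchange : ∀ x y s t → (x - y) + (s - t) ≡ (x + s) - (y + t)
    interchange = solve 4 (λ x y s t → (x :- y) :+ (s :- t) := (x :+ s) :- (y :+ t)) refl

  ∑-*ˡ : ∀ (c : ℚ) (xs : List A) (f : A → ℚ) → ∑[ a ← xs ] (c * f a) ≡ c * ∑ xs f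
  ∑-*ˡ c []       f = sym (*-zeroʳ c)
  ∑-*ˡ c (a ∷ xs) f = trans (cong (c * f a +_) (∑-*ˡ c xs f)) (sym (*-distribˡ-+ c (f a) (∑ xs f)))

  ∑-*ʳ : ∀ (c : ℚ) (xs : List A) (f : A → ℚ) → ∑[ a ← xs ] (f a * c) ≡ ∑ xs f * c
  ∑-*ʳ c []       f = sym (*-zeroˡ c)
  ∑-*ʳ c (a ∷ xs) f = trans (cong (f a * c +_) (∑-*ʳ c xs f)) (sym (*-distribʳ-+ c (f a) (∑ xs f)))

  ∑-++ : ∀ (xs ys : List A) (f : A → ℚ) → ∑ (xs ++ ys) f ≡ ∑ xs f + ∑ ys f
  ∑-++ []       ys f = sym (+-identityˡ (∑ ys f))
  ∑-++ (a ∷ xs) ys f = trans (cong (f a +_) (∑-++ xs ys f)) (sym (+-assoc (f a) (∑ xs f) (∑ ys f)))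

  ∑-map : ∀ {B : Set} (g : B → A) (xs : List B) (f : A → ℚ) → ∑ (map g xs) f ≡ ∑ xs (f ∘ g)
  ∑-map g []       f = refl
  ∑-map g (b ∷ xs) f = cong (f (g b) +_) (∑-map g xs f)

  ∑-concatMap : ∀ {B : Set} (g : B → List A) (xs : List B) (f : A → ℚ) →
                ∑ (concatMap g xs) f ≡ ∑[ b ← xs ] ∑ (g b) f
  ∑-concatMap g []       f = refl
  ∑-concatMap g (b ∷ xs) f = trans (∑-++ (g b) (concatMap g xs) f) (cong (∑ (g b) f +_) (∑-concatMap g xs f))

-- Orderings of the vertices

insertions-↭ : ∀ {A : Set} (z : A) (u : List A) {v} → v ∈ insertions z u → v ↭ z ∷ u
insertions-↭ z []       (here refl) = ↭-refl
insertions-↭ z (c ∷ cs) (here refl) = ↭-refl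
insertions-↭ z (c ∷ cs) (there v∈) with ∈-map⁻ (c ∷_) v∈
... | v , v∈′ , refl = ↭-trans (↭-prep c (insertions-↭ z cs v∈′)) (↭-swap c z ↭-refl)

permutations-↭ : ∀ {A : Set} (l : List A) {w} → w ∈ permutations l → w ↭ l
permutations-↭ []      (here refl) = ↭-refl
permutations-↭ (z ∷ l) w∈ with find (∈-concatMap⁻ (insertions z) {permutations l} w∈)
... | u , u∈ , w∈′ = ↭-trans (insertions-↭ z u w∈′) (↭-prep z (permutations-↭ l u∈))

words : ∀ n → List (List (Fin n))
words n = permutations (allFin n)

Arrangement : ∀ {n} → List (Fin n) → Set
Arrangement w = Unique w × (∀ v → v ∈ w)

words-arrangement : ∀ {n w} → w ∈ words n → Arrangement w
words-arrangement {n} w∈ =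
  Unique-resp-↭ (setoid _) (↭⇒↭ₛ (↭-sym w↭)) (allFin⁺ n) , λ v → ∈-resp-↭ (↭-sym w↭) (∈-allFin v)
  where
  w↭ = permutations-↭ (allFin n) w∈

-- Graph edits and the respects relation

Edge : ℕ → Set
Edge n = Fin n × Fin n

_≟ₑ_ : ∀ {n} (e f : Edge n) → Dec (e ≡ f)
_≟ₑ_ = ≡-dec Finₚ._≟_ Finₚ._≟_

_∈ᴳ_ : ∀ {n} → Edge n → Graph n → Set
e ∈ᴳ G = edge G (proj₁ e) (proj₂ e) ≡ true

graph : ∀ {n} → (Fin n → Fin n → Bool) → Graph n
graph e = record { edge = e }

single : ∀ {n} → Edge n → Graph n
single e = graph λ u v → does ((u , v) ≟ₑ e)

_∖_ : ∀ {n} → Graph n → Edge n → Graph n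
G ∖ e = graph λ u v → not (does ((u , v) ≟ₑ e)) ∧ edge G u v

_∪_ : ∀ {n} → Graph n → Edge n → Graph n
G ∪ e = graph λ u v → does ((u , v) ≟ₑ e) ∨ edge G u v

comap : ∀ {m n} → (Fin m → Fin n) → Graph n → Graph m
comap f G = graph λ u v → edge G (f u) (f v)

infixl 6 _∖_ _∪_
infix 4 _∈ᴳ_ _≈ᴳ_ _⊆_

_≈ᴳ_ : ∀ {n} → Graph n → Graph n → Set
G ≈ᴳ H = ∀ u v → edge G u v ≡ edge H u v

record _⊆_ {n} (G H : Graph n) : Set where
  constructor mk⊆
  field
    ⊆-edge : ∀ {u v} → edge G u v ≡ true → edge H u v ≡ true

open _⊆_ public

module _ {n : ℕ} (G : Graph n) where

  ∖-⊆ : ∀ e → G ∖ e ⊆ G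
  ∖-⊆ e = mk⊆ λ {u} {v} → proj₂ ∘ ∧-true⁻ (not (does ((u , v) ≟ₑ e)))

  ∖-removes : ∀ e → edge (G ∖ e) (proj₁ e) (proj₂ e) ≡ false
  ∖-removes e rewrite dec-true (e ≟ₑ e) refl = refl

  ∖-other : ∀ {e u v} → (u , v) ≢ e → edge (G ∖ e) u v ≡ edge G u v
  ∖-other {e} {u} {v} uv≢e rewrite dec-false ((u , v) ≟ₑ e) uv≢e = refl

  ∖-absent : ∀ {e u v} → edge G u v ≡ false → edge (G ∖ e) u v ≡ false
  ∖-absent {e} {u} {v} uv≡false rewrite uv≡false = ∧-zeroʳ (not (does ((u , v) ≟ₑ e)))

  ∖-keeps : ∀ {e u v} → (u , v) ≢ e → edge G u v ≡ true → edge (G ∖ e) u v ≡ true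
  ∖-keeps uv≢e uv = trans (∖-other uv≢e) uv

  ∖-≢ : ∀ {e u v} → edge (G ∖ e) u v ≡ true → (u , v) ≢ e
  ∖-≢ {e} uv refl = true≢false (trans (sym uv) (∖-removes e))

  ∪-adds : ∀ e → e ∈ᴳ G ∪ e
  ∪-adds e rewrite dec-true (e ≟ₑ e) refl = refl

  ∪-⊇ : ∀ e → G ⊆ G ∪ e
  ∪-⊇ e = mk⊆ λ {u} {v} uv → trans (cong (does ((u , v) ≟ₑ e) ∨_) uv) (∨-zeroʳ (does ((u , v) ≟ₑ e)))

  ∪-cases : ∀ {e u v} → edge (G ∪ e) u v ≡ true → (u , v) ≡ e ⊎ edge G u v ≡ true
  ∪-cases {e} {u} {v} uv with (u , v) ≟ₑ e
  ... | yes uv≡e = inj₁ uv≡e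
  ... | no  _    = inj₂ uv

  ∖-∪-restores : ∀ {e} → e ∈ᴳ G → G ≈ᴳ G ∖ e ∪ e
  ∖-∪-restores {e} e∈G u v with (u , v) ≟ₑ e
  ... | yes refl = e∈G
  ... | no  _    = refl

  ∪-∖-cancels : ∀ {e} → edge G (proj₁ e) (proj₂ e) ≡ false → G ∪ e ∖ e ≈ᴳ G
  ∪-∖-cancels {e} e∉G u v with (u , v) ≟ₑ e
  ... | yes refl = sym e∉G
  ... | no  _    = refl

  ∖-comm : ∀ e f → G ∖ e ∖ f ≈ᴳ G ∖ f ∖ e
  ∖-comm e f u v with (u , v) ≟ₑ e | (u , v) ≟ₑ f
  ... | yes _ | yes _ = refl
  ... | yes _ | no  _ = refl
  ... | no  _ | yes _ = refl
  ... | no  _ | no  _ = refl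

module _ {A : Set} where

  allB-cong : ∀ {p q : A → Bool} xs → (∀ a → p a ≡ q a) → allB p xs ≡ allB q xs
  allB-cong []       p≗q = refl
  allB-cong (a ∷ xs) p≗q = cong₂ _∧_ (p≗q a) (allB-cong xs p≗q)

  allB-∧ : ∀ (p q : A → Bool) xs → allB (λ a → p a ∧ q a) xs ≡ allB p xs ∧ allB q xs
  allB-∧ p q []       = refl
  allB-∧ p q (a ∷ xs) = trans (cong ((p a ∧ q a) ∧_) (allB-∧ p q xs)) (∧-interchange (p a) (q a) _ _)

  allB-true : ∀ {p : A → Bool} {xs} → (∀ {a} → a ∈ xs → p a ≡ true) → allB p xs ≡ true
  allB-true {xs = []}     all = refl
  allB-true {xs = a ∷ xs} all rewrite all (here refl) = allB-true (all ∘ there)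

  allB-∈ : ∀ {p : A → Bool} {xs a} → allB p xs ≡ true → a ∈ xs → p a ≡ true
  allB-∈ {p} {x ∷ xs} all (here refl) = proj₁ (∧-true⁻ (p x) all)
  allB-∈ {p} {x ∷ xs} all (there a∈)  = allB-∈ (proj₂ (∧-true⁻ (p x) all)) a∈

  allB-false : ∀ {p : A → Bool} {xs a} → a ∈ xs → p a ≡ false → allB p xs ≡ false
  allB-false {p} {xs} a∈ pa≡false = ≢true⇒≡false λ all → true≢false (trans (sym (allB-∈ all a∈)) pa≡false)

module _ {n : ℕ} where

  respects-∷⁻ : ∀ (G : Graph n) {b ws} → respects G (b ∷ ws) ≡ true →
                edge G b b ≡ false × (∀ {c} → c ∈ ws → edge G c b ≡ false) × respects G ws ≡ true
  respects-∷⁻ G {b} {ws} r =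
    let nl , r′ = ∧-true⁻ (not (edge G b b)) r
        none , rest = ∧-true⁻ (allB (λ c → not (edge G c b)) ws) r′
    in not-true⁻ nl , (λ c∈ → not-true⁻ (allB-∈ none c∈)) , rest

  respects-≈ : ∀ {G H : Graph n} → G ≈ᴳ H → ∀ w → respects G w ≡ respects H w
  respects-≈ G≈H []       = refl
  respects-≈ G≈H (a ∷ ws) =
    cong₂ _∧_ (cong not (G≈H a a)) (cong₂ _∧_ (allB-cong ws (λ b → cong not (G≈H b a))) (respects-≈ G≈H ws))

  respects-union : ∀ {G H K : Graph n} → (∀ u v → edge G u v ≡ edge H u v ∨ edge K u v) →
                   ∀ w → respects G w ≡ respects H w ∧ respects K w
  respects-union h []       = refl
  respects-union {G} {H} {K} h (a ∷ ws) = begin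
    not (edge G a a) ∧ allB (λ b → not (edge G b a)) ws ∧ respects G ws
      ≡⟨ cong₂ _∧_ (not-union a a) (cong₂ _∧_ (trans (allB-cong ws (λ b → not-union b a)) (allB-∧ _ _ ws))
                                              (respects-union h ws)) ⟩
    (nH ∧ nK) ∧ (aH ∧ aK) ∧ (rH ∧ rK)
      ≡⟨ cong ((nH ∧ nK) ∧_) (∧-interchange aH aK rH rK) ⟩
    (nH ∧ nK) ∧ (aH ∧ rH) ∧ (aK ∧ rK)
      ≡⟨ ∧-interchange nH nK (aH ∧ rH) (aK ∧ rK) ⟩
    (nH ∧ aH ∧ rH) ∧ (nK ∧ aK ∧ rK) ∎
    where
    open ≡-Reasoning
    not-union : ∀ u v → not (edge G u v) ≡ not (edge H u v) ∧ not (edge K u v)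
    not-union u v rewrite h u v with edge H u v
    ... | true  = refl
    ... | false = refl
    nH = not (edge H a a)
    nK = not (edge K a a)
    aH = allB (λ b → not (edge H b a)) ws
    aK = allB (λ b → not (edge K b a)) ws
    rH = respects H ws
    rK = respects K ws

  respects-∪ : ∀ (G : Graph n) e w → respects (G ∪ e) w ≡ respects G w ∧ respects (single e) w
  respects-∪ G e = respects-union λ u v → ∨-comm (does ((u , v) ≟ₑ e)) (edge G u v)

  respects-∖ : ∀ (G : Graph n) {e} → e ∈ᴳ G →
               ∀ w → respects G w ≡ respects (G ∖ e) w ∧ respects (single e) w
  respects-∖ G {e} e∈G w = trans (respects-≈ (∖-∪-restores G e∈G) w) (respects-∪ (G ∖ e) e w)

  respects-loop : ∀ (G : Graph n) {a w} → edge G a a ≡ true → a ∈ w → respects G w ≡ false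
  respects-loop G {a} {b ∷ ws} aa (here refl) rewrite aa = refl
  respects-loop G {a} {b ∷ ws} aa (there a∈)  rewrite respects-loop G aa a∈ =
    trans (cong (not (edge G b b) ∧_) (∧-zeroʳ _)) (∧-zeroʳ _)

respects-comap : ∀ {m n} (G : Graph n) (f : Fin m → Fin n) w → respects G (map f w) ≡ respects (comap f G) w
respects-comap G f []       = refl
respects-comap G f (a ∷ ws) = cong (not (edge G (f a) (f a)) ∧_) (cong₂ _∧_ (allB-map ws) (respects-comap G f ws))
  where
  allB-map : ∀ ws → allB (λ b → not (edge G b (f a))) (map f ws) ≡ allB (λ b → not (edge G (f b) (f a))) ws
  allB-map []       = refl
  allB-map (c ∷ cs) = cong (not (edge G (f c) (f a)) ∧_) (allB-map cs)

position : ∀ {n} → Fin n → List (Fin n) → ℕ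
position a []      = 0
position a (b ∷ w) = if does (b Finₚ.≟ a) then 0 else suc (position a w)

module _ {n : ℕ} where

  position-head : ∀ (a : Fin n) ws → position a (a ∷ ws) ≡ 0
  position-head a ws rewrite dec-true (a Finₚ.≟ a) refl = refl

  position-∷ : ∀ {a b : Fin n} ws → b ≢ a → position a (b ∷ ws) ≡ suc (position a ws)
  position-∷ {a} {b} ws b≢a rewrite dec-false (b Finₚ.≟ a) b≢a = refl

  respects⇒< : ∀ (G : Graph n) {w} → Unique w → respects G w ≡ true →
               ∀ {c d} → edge G c d ≡ true → c ∈ w → d ∈ w → position c w < position d w
  respects⇒< G {b ∷ ws} (b≢ ∷ u) r {c} {d} cd c∈ d∈ with respects-∷⁻ G r | c∈ | d∈
  ... | bb , _ , _ | here refl | here refl = ⊥-elim (true≢false (trans (sym cd) bb))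
  ... | _ , _ , _  | here refl | there d∈′
    rewrite position-head b ws | position-∷ ws (All.lookup b≢ d∈′) = s≤s z≤n
  ... | _ , cb , _ | there c∈′ | here refl = ⊥-elim (true≢false (trans (sym cd) (cb c∈′)))
  ... | _ , _ , r′ | there c∈′ | there d∈′
    rewrite position-∷ ws (All.lookup b≢ c∈′) | position-∷ ws (All.lookup b≢ d∈′) =
      s≤s (respects⇒< G u r′ cd c∈′ d∈′)

module _ {n : ℕ} {c d : Fin n} where

  private
    S = single (c , d)

    from-≢ : ∀ {u v} → u ≢ c → edge S u v ≡ false
    from-≢ {u} {v} u≢c = dec-false ((u , v) ≟ₑ (c , d)) (u≢c ∘ cong proj₁)

    into-≢ : ∀ {u v} → v ≢ d → edge S u v ≡ false
    into-≢ {u} {v} v≢d = dec-false ((u , v) ≟ₑ (c , d)) (v≢d ∘ cong proj₂)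

    none-into : ∀ {v} → v ≢ d → ∀ xs → allB (λ x → not (edge S x v)) xs ≡ true
    none-into v≢d xs = allB-true {xs = xs} λ {x} _ → cong not (into-≢ {x} v≢d)

  single-∉ : ∀ {w} → c ∉ w → respects S w ≡ true
  single-∉ {[]}     c∉ = refl
  single-∉ {b ∷ ws} c∉ = trans
    (cong₂ (λ s t → not s ∧ t ∧ respects S ws)
           (from-≢ (c∉ ∘ here ∘ sym))
           (allB-true {xs = ws} λ {x} x∈ → cong not (from-≢ {x} (c∉ ∘ there ∘ λ { refl → x∈ }))))
    (single-∉ (c∉ ∘ there))

  single-skip : ∀ {b} ws → b ≢ d → respects S (b ∷ ws) ≡ respects S ws
  single-skip {b} ws b≢d =
    cong₂ (λ s t → not s ∧ t ∧ respects S ws) (into-≢ {b} b≢d) (none-into b≢d ws)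

  single-head : ∀ {ws} → c ≢ d → c ∉ ws → respects S (c ∷ ws) ≡ true
  single-head {ws} c≢d c∉ = trans
    (cong₂ (λ s t → not s ∧ t ∧ respects S ws) (into-≢ {c} c≢d) (none-into c≢d ws))
    (single-∉ c∉)

  single-after : ∀ {ws} → c ∈ ws → respects S (d ∷ ws) ≡ false
  single-after {ws} c∈ = trans
    (cong (λ t → not (edge S d d) ∧ t ∧ respects S ws) (allB-false c∈ (cong not (dec-true ((c , d) ≟ₑ (c , d)) refl))))
    (∧-zeroʳ _)

  single⇒< : ∀ {w} → Unique w → c ∈ w → d ∈ w → respects S w ≡ true → position c w < position d w
  single⇒< u c∈ d∈ r = respects⇒< S u r (dec-true ((c , d) ≟ₑ (c , d)) refl) c∈ d∈

single-total : ∀ {n} {c d : Fin n} {w} → Unique w → c ∈ w → d ∈ w → c ≢ d →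
               respects (single (c , d)) w ≡ true ⊎ respects (single (d , c)) w ≡ true
single-total {w = b ∷ ws} (b≢ ∷ u) (here refl) d∈ c≢d = inj₁ (single-head c≢d (All¬⇒¬Any b≢))
single-total {w = b ∷ ws} (b≢ ∷ u) (there c∈) (here refl) c≢d = inj₂ (single-head (c≢d ∘ sym) (All¬⇒¬Any b≢))
single-total {c = c} {d} {w = b ∷ ws} (b≢ ∷ u) (there c∈) (there d∈) c≢d
  rewrite single-skip {c = c} {d} ws (All.lookup b≢ d∈) | single-skip {c = d} {c} ws (All.lookup b≢ c∈) =
    single-total u c∈ d∈ c≢d

single-flip : ∀ {n} {c d : Fin n} {w} → Unique w → c ∈ w → d ∈ w → c ≢ d →
              respects (single (c , d)) w ≡ not (respects (single (d , c)) w)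
single-flip {c = c} {d} {w} u c∈ d∈ c≢d
  with respects (single (c , d)) w in cd | respects (single (d , c)) w in dc
... | true  | true  = ⊥-elim (<-asym (single⇒< u c∈ d∈ cd) (single⇒< u d∈ c∈ dc))
... | true  | false = refl
... | false | true  = refl
... | false | false with single-total u c∈ d∈ c≢d
...   | inj₁ cd′ = ⊥-elim (true≢false (trans (sym cd′) cd))
...   | inj₂ dc′ = ⊥-elim (true≢false (trans (sym dc′) dc))

<⇒single : ∀ {n} {c d : Fin n} {w} → Unique w → c ∈ w → d ∈ w →
           position c w < position d w → respects (single (c , d)) w ≡ true
<⇒single u c∈ d∈ c<d with single-total u c∈ d∈ (λ { refl → <-irrefl refl c<d })
... | inj₁ cd = cd
... | inj₂ dc = ⊥-elim (<-asym c<d (single⇒< u d∈ c∈ dc))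

-- Ψ, the arc product and N

Ψ′ : ∀ {n} → Graph n → (Fin n → ℚ) → ℚ
Ψ′ {n} G x = ∑[ w ← words n ] 𝟙 (respects G w) * wordTerm x w

-- The filter used by linExts is local to Defs, so the type of Ψ-filter is left for unification.
mutual
  Ψ≡Ψ′ : ∀ {n} (G : Graph n) x → Ψ G x ≡ Ψ′ G x
  Ψ≡Ψ′ {n} G x with words n
  ... | ws = Ψ-filter G x ws

  Ψ-filter : ∀ {n} (G : Graph n) x ws → _ ≡ ∑[ w ← ws ] 𝟙 (respects G w) * wordTerm x w
  Ψ-filter G x []       = refl
  Ψ-filter G x (w ∷ ws) with respects G w
  ... | true  = cong₂ _+_ (sym (*-identityˡ (wordTerm x w))) (Ψ-filter G x ws)
  ... | false = trans (Ψ-filter G x ws) (sym (trans (cong (_+ _) (*-zeroˡ (wordTerm x w))) (+-identityˡ _)))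

∏ : ∀ {n} → (Fin n → ℚ) → ℚ
∏ {zero}  f = 1ℚ
∏ {suc n} f = f zero * ∏ (f ∘ suc)

∏-cong : ∀ {n} {f g : Fin n → ℚ} → (∀ i → f i ≡ g i) → ∏ f ≡ ∏ g
∏-cong {zero}  f≗g = refl
∏-cong {suc n} f≗g = cong₂ _*_ (f≗g zero) (∏-cong (f≗g ∘ suc))

∏-one : ∀ n → ∏ {n} (λ _ → 1ℚ) ≡ 1ℚ
∏-one zero    = refl
∏-one (suc n) = trans (*-identityˡ _) (∏-one n)

∏-single-factor : ∀ {n} (f g : Fin n → ℚ) (c : ℚ) j →
                  (∀ i → i ≢ j → f i ≡ g i) → f j ≡ c * g j → ∏ f ≡ c * ∏ g
∏-single-factor {suc n} f g c zero f≗g fj =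
  trans (cong₂ _*_ fj (∏-cong λ i → f≗g (suc i) λ ())) (*-assoc c (g zero) (∏ (g ∘ suc)))
∏-single-factor {suc n} f g c (suc j) f≗g fj =
  trans (cong₂ _*_ (f≗g zero λ ())
                   (∏-single-factor (f ∘ suc) (g ∘ suc) c j (λ i i≢j → f≗g (suc i) (i≢j ∘ suc-injective)) fj))
        (swap-front (g zero) c (∏ (g ∘ suc)))
  where
  swap-front : ∀ a c p → a * (c * p) ≡ c * (a * p)
  swap-front = solve 3 (λ a c p → a :* (c :* p) := c :* (a :* p)) refl

∏-tabulate : ∀ {A : Set} {n} (h : A → ℚ) (f : Fin n → A) → prodℚ (map h (tabulate f)) ≡ ∏ (h ∘ f)
∏-tabulate {n = zero}  h f = refl
∏-tabulate {n = suc n} h f = cong (h (f zero) *_) (∏-tabulate h (f ∘ suc))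

arcFactor : Bool → ℚ → ℚ
arcFactor true  d = d
arcFactor false d = 1ℚ

edgeProd′ : ∀ {n} → Graph n → (Fin n → ℚ) → ℚ
edgeProd′ G x = ∏ λ u → ∏ λ v → arcFactor (edge G u v) (x u - x v)

prodℚ-concatMap : ∀ {A : Set} (f : A → List ℚ) (xs : List A) →
                  prodℚ (concatMap f xs) ≡ prodℚ (map (prodℚ ∘ f) xs)
prodℚ-concatMap f []       = refl
prodℚ-concatMap f (a ∷ xs) = trans (prodℚ-++ (f a) (concatMap f xs)) (cong (prodℚ (f a) *_) (prodℚ-concatMap f xs))
  where
  prodℚ-++ : ∀ xs ys → prodℚ (xs ++ ys) ≡ prodℚ xs * prodℚ ys
  prodℚ-++ []       ys = sym (*-identityˡ (prodℚ ys))
  prodℚ-++ (x ∷ xs) ys = trans (cong (x *_) (prodℚ-++ xs ys)) (sym (*-assoc x (prodℚ xs) (prodℚ ys)))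

prodℚ-cong : ∀ {A : Set} {f g : A → ℚ} xs → (∀ a → f a ≡ g a) → prodℚ (map f xs) ≡ prodℚ (map g xs)
prodℚ-cong []       f≗g = refl
prodℚ-cong (a ∷ xs) f≗g = cong₂ _*_ (f≗g a) (prodℚ-cong xs f≗g)

-- As for Ψ, the list of factors built by edgeProd is local to Defs.
mutual
  edgeProd≡edgeProd′ : ∀ {n} (G : Graph n) x → edgeProd G x ≡ edgeProd′ G x
  edgeProd≡edgeProd′ {n} G x =
    trans (prodℚ-concatMap _ (allFin n))
   (trans (prodℚ-cong (allFin n) λ u →
             trans (prodℚ-concatMap _ (allFin n))
            (trans (prodℚ-cong (allFin n) (arc-factor G x u))
                   (∏-tabulate (λ v → arcFactor (edge G u v) (x u - x v)) (λ v → v))))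
          (∏-tabulate (λ u → ∏ λ v → arcFactor (edge G u v) (x u - x v)) (λ u → u)))

  arc-factor : ∀ {n} (G : Graph n) x (u v : Fin n) → _ ≡ arcFactor (edge G u v) (x u - x v)
  arc-factor G x u v with edge G u v
  ... | true  = *-identityʳ _
  ... | false = refl

N′ : ∀ {n} → Graph n → (Fin n → ℚ) → ℚ
N′ G x = Ψ′ G x * edgeProd′ G x

N≡N′ : ∀ {n} (G : Graph n) x → N G x ≡ N′ G x
N≡N′ G x = cong₂ _*_ (Ψ≡Ψ′ G x) (edgeProd≡edgeProd′ G x)

module _ {n : ℕ} (x : Fin n → ℚ) where

  edgeProd′-≈ : ∀ {G H : Graph n} → G ≈ᴳ H → edgeProd′ G x ≡ edgeProd′ H x
  edgeProd′-≈ G≈H = ∏-cong λ u → ∏-cong λ v → cong (λ b → arcFactor b (x u - x v)) (G≈H u v)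

  edgeProd′-∖ : ∀ (G : Graph n) {a b} → edge G a b ≡ true →
                edgeProd′ G x ≡ (x a - x b) * edgeProd′ (G ∖ (a , b)) x
  edgeProd′-∖ G {a} {b} ab = ∏-single-factor _ _ (x a - x b) a other-rows row-a
    where
    row : Graph n → Fin n → ℚ
    row H u = ∏ λ v → arcFactor (edge H u v) (x u - x v)
    other-rows : ∀ u → u ≢ a → row G u ≡ row (G ∖ (a , b)) u
    other-rows u u≢a = ∏-cong λ v → cong (λ t → arcFactor t (x u - x v)) (sym (∖-other G (u≢a ∘ cong proj₁)))
    row-a : row G a ≡ (x a - x b) * row (G ∖ (a , b)) a
    row-a = ∏-single-factor _ _ (x a - x b) b other-cols col-b
      where
      other-cols : ∀ v → v ≢ b → arcFactor (edge G a v) (x a - x v) ≡ arcFactor (edge (G ∖ (a , b)) a v) (x a - x v)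
      other-cols v v≢b = cong (λ t → arcFactor t (x a - x v)) (sym (∖-other G (v≢b ∘ cong proj₂)))
      col-b : arcFactor (edge G a b) (x a - x b) ≡ (x a - x b) * arcFactor (edge (G ∖ (a , b)) a b) (x a - x b)
      col-b rewrite ∖-removes G (a , b) | ab = sym (*-identityʳ (x a - x b))

  edgeProd′-∪ : ∀ (G : Graph n) {a b} → edge G a b ≡ false →
                edgeProd′ (G ∪ (a , b)) x ≡ (x a - x b) * edgeProd′ G x
  edgeProd′-∪ G {a} {b} ab∉G =
    trans (edgeProd′-∖ (G ∪ (a , b)) (∪-adds G (a , b))) (cong ((x a - x b) *_) (edgeProd′-≈ (∪-∖-cancels G ab∉G)))

-- Reachability

count : ∀ {n} → (Fin n → Bool) → ℕ
count {zero}  f = 0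
count {suc n} f = (if f zero then 1 else 0) ℕ.+ count (f ∘ suc)

_⊆ᵇ_ : ∀ {n} → (Fin n → Bool) → (Fin n → Bool) → Set
f ⊆ᵇ g = ∀ i → f i ≡ true → g i ≡ true

count-≤ : ∀ {n} (f : Fin n → Bool) → count f ≤ n
count-≤ {zero}  f = z≤n
count-≤ {suc n} f with f zero
... | true  = s≤s (count-≤ (f ∘ suc))
... | false = ℕₚ.m≤n⇒m≤1+n (count-≤ (f ∘ suc))

count-mono : ∀ {n} {f g : Fin n → Bool} → f ⊆ᵇ g → count f ≤ count g
count-mono {zero}          f⊆g = z≤n
count-mono {suc n} {f} {g} f⊆g with f zero in f0 | g zero in g0
... | true  | true  = s≤s (count-mono (f⊆g ∘ suc))
... | true  | false = ⊥-elim (true≢false (trans (sym (f⊆g zero f0)) g0))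
... | false | true  = ℕₚ.m≤n⇒m≤1+n (count-mono (f⊆g ∘ suc))
... | false | false = count-mono (f⊆g ∘ suc)

count-strict : ∀ {n} {f g : Fin n → Bool} → f ⊆ᵇ g → ∀ j → f j ≡ false → g j ≡ true → count f < count g
count-strict {suc n} {f} {g} f⊆g zero fj gj rewrite fj | gj = s≤s (count-mono (f⊆g ∘ suc))
count-strict {suc n} {f} {g} f⊆g (suc j) fj gj with f zero in f0 | g zero in g0
... | true  | true  = s≤s (count-strict (f⊆g ∘ suc) j fj gj)
... | true  | false = ⊥-elim (true≢false (trans (sym (f⊆g zero f0)) g0))
... | false | true  = ℕₚ.m≤n⇒m≤1+n (count-strict (f⊆g ∘ suc) j fj gj)
... | false | false = count-strict (f⊆g ∘ suc) j fj gj

count-≤-suc : ∀ {n} {f g : Fin n → Bool} j → (∀ i → i ≢ j → g i ≡ true → f i ≡ true) → count g ≤ suc (count f)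
count-≤-suc {suc n} {f} {g} zero g⊆f with f zero | g zero
... | true  | true  = s≤s (ℕₚ.m≤n⇒m≤1+n (count-mono λ i → g⊆f (suc i) λ ()))
... | false | true  = s≤s (count-mono λ i → g⊆f (suc i) λ ())
... | true  | false = ℕₚ.m≤n⇒m≤1+n (ℕₚ.m≤n⇒m≤1+n (count-mono λ i → g⊆f (suc i) λ ()))
... | false | false = ℕₚ.m≤n⇒m≤1+n (count-mono λ i → g⊆f (suc i) λ ())
count-≤-suc {suc n} {f} {g} (suc j) g⊆f with f zero in f0 | g zero in g0
... | true  | true  = s≤s (count-≤-suc j λ i i≢j → g⊆f (suc i) (i≢j ∘ suc-injective))
... | false | true  = ⊥-elim (true≢false (trans (sym (g⊆f zero (λ ()) g0)) f0))
... | true  | false = ℕₚ.m≤n⇒m≤1+n (count-≤-suc j λ i i≢j → g⊆f (suc i) (i≢j ∘ suc-injective))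
... | false | false = count-≤-suc j λ i i≢j → g⊆f (suc i) (i≢j ∘ suc-injective)

anyᵇ : ∀ {n} → (Fin n → Bool) → Bool
anyᵇ {zero}  f = false
anyᵇ {suc n} f = f zero ∨ anyᵇ (f ∘ suc)

anyᵇ-true⁻ : ∀ {n} (f : Fin n → Bool) → anyᵇ f ≡ true → ∃ λ i → f i ≡ true
anyᵇ-true⁻ {suc n} f any with ∨-true⁻ (f zero) any
... | inj₁ f0 = zero , f0
... | inj₂ fs = let i , fi = anyᵇ-true⁻ (f ∘ suc) fs in suc i , fi

anyᵇ-true⁺ : ∀ {n} (f : Fin n → Bool) i → f i ≡ true → anyᵇ f ≡ true
anyᵇ-true⁺ f zero    fi rewrite fi = refl
anyᵇ-true⁺ f (suc i) fi = trans (cong (f zero ∨_) (anyᵇ-true⁺ (f ∘ suc) i fi)) (∨-zeroʳ (f zero))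

module _ {n : ℕ} {G : Graph n} where

  Reach-trans : ∀ {a b c} → Reach G a b → Reach G b c → Reach G a c
  Reach-trans here        q = q
  Reach-trans (fwd ab p)  q = fwd ab (Reach-trans p q)
  Reach-trans (bwd ba p)  q = bwd ba (Reach-trans p q)

  Reach-sym : ∀ {a b} → Reach G a b → Reach G b a
  Reach-sym here       = here
  Reach-sym (fwd ab p) = Reach-trans (Reach-sym p) (bwd ab here)
  Reach-sym (bwd ba p) = Reach-trans (Reach-sym p) (fwd ba here)

  arc : ∀ {a b} → edge G a b ≡ true → Reach G a b
  arc ab = fwd ab here

  arc⁻ : ∀ {a b} → edge G b a ≡ true → Reach G a b
  arc⁻ ba = bwd ba here

Reach-map : ∀ {n} {G H : Graph n} → (∀ {a b} → edge G a b ≡ true → Reach H a b) →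
            ∀ {s t} → Reach G s t → Reach H s t
Reach-map h here       = here
Reach-map h (fwd ab p) = Reach-trans (h ab) (Reach-map h p)
Reach-map h (bwd ba p) = Reach-trans (Reach-sym (h ba)) (Reach-map h p)

Reach-image : ∀ {m n} {H : Graph m} {G : Graph n} (f : Fin m → Fin n) →
              (∀ {u v} → edge H u v ≡ true → Reach G (f u) (f v)) → ∀ {a b} → Reach H a b → Reach G (f a) (f b)
Reach-image f h here       = here
Reach-image f h (fwd uv r) = Reach-trans (h uv) (Reach-image f h r)
Reach-image f h (bwd vu r) = Reach-trans (Reach-sym (h vu)) (Reach-image f h r)

Reach-⊆ : ∀ {n} {G H : Graph n} → G ⊆ H → ∀ {s t} → Reach G s t → Reach H s t
Reach-⊆ G⊆H = Reach-map (arc ∘ ⊆-edge G⊆H)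

¬Connected-⊆ : ∀ {n} {G H : Graph n} → H ⊆ G → ¬ Connected G → ¬ Connected H
¬Connected-⊆ H⊆G ¬cG cH = ¬cG λ u v → Reach-⊆ H⊆G (cH u v)

-- The n-th iterate of "add all neighbours" is closed: until it closes, each iterate gains a vertex.
module BreadthFirst {n : ℕ} (G : Graph n) (a : Fin n) where

  adjacent : Fin n → Fin n → Bool
  adjacent u v = edge G u v ∨ edge G v u

  expand : (Fin n → Bool) → Fin n → Bool
  expand R v = R v ∨ anyᵇ (λ u → R u ∧ adjacent u v)

  reached : ℕ → Fin n → Bool
  reached zero    v = does (a Finₚ.≟ v)
  reached (suc k) = expand (reached k)

  Closed : (Fin n → Bool) → Set
  Closed R = ∀ u v → R u ≡ true → adjacent u v ≡ true → R v ≡ true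

  expand-⊇ : ∀ R → R ⊆ᵇ expand R
  expand-⊇ R v Rv rewrite Rv = refl

  adjacent⇒Reach : ∀ {u v} → adjacent u v ≡ true → Reach G u v
  adjacent⇒Reach {u} {v} uv with ∨-true⁻ (edge G u v) uv
  ... | inj₁ e = arc e
  ... | inj₂ e = arc⁻ e

  sound : ∀ k v → reached k v ≡ true → Reach G a v
  sound zero    v a≡v with a Finₚ.≟ v
  ... | yes refl = here
  sound (suc k) v rv with ∨-true⁻ (reached k v) rv
  ... | inj₁ rv′ = sound k v rv′
  ... | inj₂ any with anyᵇ-true⁻ (λ u → reached k u ∧ adjacent u v) any
  ...   | u , ru∧uv = let ru , uv = ∧-true⁻ (reached k u) ru∧uv in Reach-trans (sound k u ru) (adjacent⇒Reach uv)

  complete : ∀ R → Closed R → ∀ {u v} → R u ≡ true → Reach G u v → R v ≡ true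
  complete R closed Ru here                 = Ru
  complete R closed {u} Ru (fwd {v = w} e p) = complete R closed (closed u w Ru (cong (_∨ edge G w u) e)) p
  complete R closed {u} Ru (bwd {v = w} e p) = complete R closed (closed u w Ru (trans (cong (edge G u w ∨_) e) (∨-zeroʳ _))) p

  closed-or-grows : ∀ R → Closed R ⊎ ∃ λ v → R v ≡ false × expand R v ≡ true
  closed-or-grows R with anyᵇ (λ v → not (R v) ∧ expand R v) in any
  ... | true = let v , nv = anyᵇ-true⁻ (λ v → not (R v) ∧ expand R v) any
                   ¬Rv , eRv = ∧-true⁻ (not (R v)) nv
               in inj₂ (v , not-true⁻ ¬Rv , eRv)
  ... | false = inj₁ closed
    where
    closed : Closed R
    closed u v Ru uv with R v in Rv
    ... | true  = refl
    ... | false = ⊥-elim (true≢false (trans (sym (anyᵇ-true⁺ (λ v → not (R v) ∧ expand R v) v new)) any))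
      where
      new : not (R v) ∧ expand R v ≡ true
      new rewrite Rv = anyᵇ-true⁺ (λ w → R w ∧ adjacent w v) u (trans (cong (_∧ adjacent u v) Ru) uv)

  expand-closed : ∀ R → Closed R → Closed (expand R)
  expand-closed R closed u v eRu uv = expand-⊇ R v (closed u v (shrink eRu) uv)
    where
    shrink : expand R u ≡ true → R u ≡ true
    shrink eRu with ∨-true⁻ (R u) eRu
    ... | inj₁ Ru  = Ru
    ... | inj₂ any = let w , rw = anyᵇ-true⁻ _ any
                         Rw , wu = ∧-true⁻ (R w) rw
                     in closed w u Rw wu

  grows-until-closed : ∀ k → suc k ≤ count (reached k) ⊎ Closed (reached k)
  grows-until-closed zero = inj₁ (subst (_≤ count (reached zero)) (cong suc (count-none n)) one)
    where
    count-none : ∀ m → count {m} (λ _ → false) ≡ 0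
    count-none zero    = refl
    count-none (suc m) = count-none m
    one : suc (count {n} (λ _ → false)) ≤ count (reached zero)
    one = count-strict (λ _ ()) a refl (dec-true (a Finₚ.≟ a) refl)
  grows-until-closed (suc k) with grows-until-closed k
  ... | inj₂ closed = inj₂ (expand-closed (reached k) closed)
  ... | inj₁ size with closed-or-grows (reached k)
  ...   | inj₁ closed          = inj₂ (expand-closed (reached k) closed)
  ...   | inj₂ (v , old , new) = inj₁ (ℕₚ.≤-trans (s≤s size) (count-strict (expand-⊇ (reached k)) v old new))

  reached-closed : Closed (reached n)
  reached-closed with grows-until-closed n
  ... | inj₂ closed = closed
  ... | inj₁ size   = ⊥-elim (<-irrefl refl (ℕₚ.≤-trans size (count-≤ (reached n))))

  reached-start : reached n a ≡ true
  reached-start = go n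
    where
    go : ∀ k → reached k a ≡ true
    go zero    = dec-true (a Finₚ.≟ a) refl
    go (suc k) = expand-⊇ (reached k) a (go k)

  Reach? : ∀ b → Dec (Reach G a b)
  Reach? b with reached n b in rb
  ... | true  = yes (sound n b rb)
  ... | false = no λ r → true≢false (trans (sym (complete (reached n) reached-closed reached-start r)) rb)

open BreadthFirst using (Reach?)

Connected? : ∀ {n} (G : Graph n) → Dec (Connected G)
Connected? G = Finₚ.all? λ u → Finₚ.all? λ v → Reach? G u v

sumᴺ : ∀ {n} → (Fin n → ℕ) → ℕ
sumᴺ {zero}  f = 0
sumᴺ {suc n} f = f zero ℕ.+ sumᴺ (f ∘ suc)

sumᴺ-mono : ∀ {n} {f g : Fin n → ℕ} → (∀ i → f i ≤ g i) → sumᴺ f ≤ sumᴺ g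
sumᴺ-mono {zero}  f≤g = z≤n
sumᴺ-mono {suc n} f≤g = ℕₚ.+-mono-≤ (f≤g zero) (sumᴺ-mono (f≤g ∘ suc))

sumᴺ-strict : ∀ {n} {f g : Fin n → ℕ} → (∀ i → f i ≤ g i) → ∀ j → f j < g j → sumᴺ f < sumᴺ g
sumᴺ-strict {suc n} f≤g zero    fj<gj = ℕₚ.+-mono-<-≤ fj<gj (sumᴺ-mono (f≤g ∘ suc))
sumᴺ-strict {suc n} f≤g (suc j) fj<gj = ℕₚ.+-mono-≤-< (f≤g zero) (sumᴺ-strict (f≤g ∘ suc) j fj<gj)

edgeCount : ∀ {n} → Graph n → ℕ
edgeCount G = sumᴺ λ u → count (edge G u)

edgeCount-∖ : ∀ {n} (G : Graph n) {a b} → edge G a b ≡ true → edgeCount (G ∖ (a , b)) < edgeCount G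
edgeCount-∖ G {a} {b} ab =
  sumᴺ-strict (λ u → count-mono λ v → ⊆-edge (∖-⊆ G (a , b)) {u} {v}) a
              (count-strict (λ v → ⊆-edge (∖-⊆ G (a , b)) {a} {v}) b (∖-removes G (a , b)) ab)

Distinct : ∀ {n} → (Fin n → ℚ) → Set
Distinct x = Injective _≡_ _≡_ x

PolyVanish : ∀ {n} → Graph n → ((Fin n → ℚ) → ℚ) → Set
PolyVanish {n} G f =
  Σ (Poly n) λ P → (∀ x → Distinct x → f x ≡ eval P x) × (¬ Connected G → ∀ x → Distinct x → f x ≡ 0ℚ)

module _ {n : ℕ} {G : Graph n} where

  zero-polyVanish : ∀ {f : (Fin n → ℚ) → ℚ} → (∀ x → Distinct x → f x ≡ 0ℚ) → PolyVanish G f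
  zero-polyVanish f≡0 = con 0ℚ , f≡0 , λ _ → f≡0

  polyVanish-cong : ∀ {f g : (Fin n → ℚ) → ℚ} → (∀ x → Distinct x → f x ≡ g x) → PolyVanish G f → PolyVanish G g
  polyVanish-cong f≡g (P , f≡P , f≡0) =
    P , (λ x d → trans (sym (f≡g x d)) (f≡P x d)) , (λ ¬c x d → trans (sym (f≡g x d)) (f≡0 ¬c x d))

  polyVanish-+ : ∀ {f g : (Fin n → ℚ) → ℚ} → PolyVanish G f → PolyVanish G g → PolyVanish G (λ x → f x + g x)
  polyVanish-+ (P , f≡P , f≡0) (Q , g≡Q , g≡0) =
    P ⊕ Q , (λ x d → cong₂ _+_ (f≡P x d) (g≡Q x d)) , (λ ¬c x d → cong₂ _+_ (f≡0 ¬c x d) (g≡0 ¬c x d))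

  polyVanish-* : ∀ (Q : Poly n) {f : (Fin n → ℚ) → ℚ} → PolyVanish G f → PolyVanish G (λ x → eval Q x * f x)
  polyVanish-* Q (P , f≡P , f≡0) =
    Q ⊗ P , (λ x d → cong (eval Q x *_) (f≡P x d)) , (λ ¬c x d → trans (cong (eval Q x *_) (f≡0 ¬c x d)) (*-zeroʳ (eval Q x)))

  polyVanish-⊆ : ∀ {H : Graph n} {f : (Fin n → ℚ) → ℚ} → H ⊆ G → PolyVanish H f → PolyVanish G f
  polyVanish-⊆ H⊆G (P , f≡P , f≡0) = P , f≡P , f≡0 ∘ ¬Connected-⊆ H⊆G

Ψ′-loop : ∀ {n} (G : Graph n) {a} → edge G a a ≡ true → ∀ x → Ψ′ G x ≡ 0ℚ
Ψ′-loop G aa x = ∑-zero λ {w} w∈ →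
  trans (cong (λ b → 𝟙 b * wordTerm x w) (respects-loop G aa (proj₂ (words-arrangement w∈) _))) (*-zeroˡ (wordTerm x w))

-- Graphs with a cycle


Step : ∀ {n} → Graph n → Fin n → Fin n → Set
Step H a c = edge H a c ≡ true ⊎ edge H c a ≡ true

data SimplePath {n} (H : Graph n) : Fin n → Fin n → List (Fin n) → Set where
  stop : ∀ {b} → SimplePath H b b (b ∷ [])
  step : ∀ {a c b vs} → Step H a c → SimplePath H c b vs → a ∉ vs → SimplePath H a b (a ∷ vs)

module _ {n : ℕ} {H : Graph n} where

  start∈ : ∀ {a b vs} → SimplePath H a b vs → a ∈ vs
  start∈ stop         = here refl
  start∈ (step _ _ _) = here refl

  shortcut : ∀ {c b vs} → SimplePath H c b vs → ∀ {a} → a ∈ vs → ∃ (SimplePath H a b)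
  shortcut stop            (here refl) = _ , stop
  shortcut (step s p c∉)   (here refl) = _ , step s p c∉
  shortcut (step _ p _)    (there a∈)  = shortcut p a∈

  prepend : ∀ {a c b vs} → Step H a c → SimplePath H c b vs → ∃ (SimplePath H a b)
  prepend {a} {vs = vs} s p with any? (a Finₚ.≟_) vs
  ... | yes a∈ = shortcut p a∈
  ... | no  a∉ = _ , step s p a∉

  Reach⇒SimplePath : ∀ {a b} → Reach H a b → ∃ (SimplePath H a b)
  Reach⇒SimplePath here      = _ , stop
  Reach⇒SimplePath (fwd e r) = prepend (inj₁ e) (proj₂ (Reach⇒SimplePath r))
  Reach⇒SimplePath (bwd e r) = prepend (inj₂ e) (proj₂ (Reach⇒SimplePath r))

  forwardArcs : ∀ {a b vs} → SimplePath H a b vs → List (Edge n)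
  forwardArcs stop                       = []
  forwardArcs (step {a} {c} (inj₁ _) p _) = (a , c) ∷ forwardArcs p
  forwardArcs (step         (inj₂ _) p _) = forwardArcs p

  backwardArcs : ∀ {a b vs} → SimplePath H a b vs → List (Edge n)
  backwardArcs stop                       = []
  backwardArcs (step         (inj₁ _) p _) = backwardArcs p
  backwardArcs (step {a} {c} (inj₂ _) p _) = (c , a) ∷ backwardArcs p

  forwardArcs-⊆ : ∀ {a b vs} (p : SimplePath H a b vs) {e} → e ∈ forwardArcs p → e ∈ᴳ H
  forwardArcs-⊆ (step (inj₁ ac) p _) (here refl) = ac
  forwardArcs-⊆ (step (inj₁ _)  p _) (there e∈)  = forwardArcs-⊆ p e∈
  forwardArcs-⊆ (step (inj₂ _)  p _) e∈          = forwardArcs-⊆ p e∈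

  backwardArcs-⊆ : ∀ {a b vs} (p : SimplePath H a b vs) {e} → e ∈ backwardArcs p → e ∈ᴳ H
  backwardArcs-⊆ (step (inj₁ _)  p _) e∈          = backwardArcs-⊆ p e∈
  backwardArcs-⊆ (step (inj₂ ca) p _) (here refl) = ca
  backwardArcs-⊆ (step (inj₂ _)  p _) (there e∈)  = backwardArcs-⊆ p e∈

  Within : List (Fin n) → Edge n → Set
  Within vs (c , d) = c ∈ vs × d ∈ vs

  forwardArcs-within : ∀ {a b vs} (p : SimplePath H a b vs) {e} → e ∈ forwardArcs p → Within vs e
  forwardArcs-within (step (inj₁ _) p _) (here refl) = here refl , there (start∈ p)
  forwardArcs-within (step (inj₁ _) p _) (there e∈)  = Data.Product.map there there (forwardArcs-within p e∈)
  forwardArcs-within (step (inj₂ _) p _) e∈          = Data.Product.map there there (forwardArcs-within p e∈)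

  backwardArcs-within : ∀ {a b vs} (p : SimplePath H a b vs) {e} → e ∈ backwardArcs p → Within vs e
  backwardArcs-within (step (inj₁ _) p _) e∈          = Data.Product.map there there (backwardArcs-within p e∈)
  backwardArcs-within (step (inj₂ _) p _) (here refl) = there (start∈ p) , here refl
  backwardArcs-within (step (inj₂ _) p _) (there e∈)  = Data.Product.map there there (backwardArcs-within p e∈)

  backwardArcs-unique : ∀ {a b vs} (p : SimplePath H a b vs) → Unique (backwardArcs p)
  backwardArcs-unique stop                  = []
  backwardArcs-unique (step (inj₁ _) p _)   = backwardArcs-unique p
  backwardArcs-unique (step (inj₂ _) p a∉) =
    ¬Any⇒All¬ _ (a∉ ∘ proj₂ ∘ backwardArcs-within p) ∷ backwardArcs-unique p

  forward∉backward : ∀ {a b vs} (p : SimplePath H a b vs) {e} → e ∈ forwardArcs p → e ∉ backwardArcs p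
  forward∉backward (step (inj₁ _) p a∉) (here refl) e∈′ = a∉ (proj₁ (backwardArcs-within p e∈′))
  forward∉backward (step (inj₁ _) p _)  (there e∈) e∈′  = forward∉backward p e∈ e∈′
  forward∉backward (step (inj₂ _) p a∉) e∈ (here refl)  = a∉ (proj₂ (forwardArcs-within p e∈))
  forward∉backward (step (inj₂ _) p _)  e∈ (there e∈′)  = forward∉backward p e∈ e∈′

  position-along : ∀ {a b vs} (p : SimplePath H a b vs) (w : List (Fin n)) →
                   (∀ {e} → e ∈ forwardArcs p  → position (proj₁ e) w < position (proj₂ e) w) →
                   (∀ {e} → e ∈ backwardArcs p → position (proj₂ e) w < position (proj₁ e) w) →
                   position a w ≤ position b w
  position-along stop                w f g = ℕₚ.≤-refl
  position-along (step (inj₁ _) p _) w f g = ℕₚ.<⇒≤ (ℕₚ.<-≤-trans (f (here refl)) (position-along p w (f ∘ there) g))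
  position-along (step (inj₂ _) p _) w f g = ℕₚ.<⇒≤ (ℕₚ.<-≤-trans (g (here refl)) (position-along p w f (g ∘ there)))

_∖∖_ : ∀ {n} → Graph n → List (Edge n) → Graph n
G ∖∖ es = graph λ u v → not (does (any? ((u , v) ≟ₑ_) es)) ∧ edge G u v

infixl 6 _∖∖_

allReversed : ∀ {n} → List (Edge n) → List (Fin n) → Bool
allReversed es w = allB (λ e → not (respects (single e) w)) es

-- alt G es w = ∑_{S ⊆ es} (-1)^|S| 𝟙[w respects G ∖ S]
alt : ∀ {n} → Graph n → List (Edge n) → List (Fin n) → ℚ
alt G []       w = 𝟙 (respects G w)
alt G (e ∷ es) w = alt G es w - alt (G ∖ e) es w

sign : ∀ {A : Set} → List A → ℚ
sign []       = 1ℚ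
sign (_ ∷ es) = - sign es

module _ {n : ℕ} where

  ∖∖-∷ : ∀ (G : Graph n) e es → G ∖∖ (e ∷ es) ≈ᴳ G ∖ e ∖∖ es
  ∖∖-∷ G e es u v with (u , v) ≟ₑ e
  ... | yes _ = sym (∧-zeroʳ _)
  ... | no  _ = refl

  ∖∖-restore : ∀ (G : Graph n) {e es} → e ∈ᴳ G → e ∉ es →
               ∀ u v → edge (G ∖∖ es) u v ≡ edge (G ∖∖ (e ∷ es)) u v ∨ edge (single e) u v
  ∖∖-restore G {e} {es} e∈G e∉es u v with (u , v) ≟ₑ e
  ... | yes refl rewrite dec-false (any? (e ≟ₑ_) es) e∉es | e∈G = refl
  ... | no  _    = sym (∨-identityʳ _)

  alt-closed-form : ∀ (G : Graph n) es w → Unique es → All (_∈ᴳ G) es →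
                    alt G es w ≡ sign es * 𝟙 (respects (G ∖∖ es) w ∧ allReversed es w)
  alt-closed-form G [] w _ _ =
    sym (trans (*-identityˡ _) (cong 𝟙 (∧-identityʳ (respects G w))))
  alt-closed-form G (e ∷ es) w (e≢ ∷ u) (e∈G ∷ es⊆G) = begin
    alt G es w - alt (G ∖ e) es w
      ≡⟨ cong₂ _-_ (alt-closed-form G es w u es⊆G)
                   (alt-closed-form (G ∖ e) es w u
                      (All.zipWith (λ (e≢f , f∈G) → ∖-keeps G (e≢f ∘ sym) f∈G) (e≢ , es⊆G))) ⟩
    sign es * 𝟙 (R₀ ∧ Rev) - sign es * 𝟙 (R₁ ∧ Rev)
      ≡⟨ cong₂ (λ s t → sign es * 𝟙 (s ∧ Rev) - sign es * 𝟙 (t ∧ Rev)) R₀≡ R₁≡ ⟩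
    sign es * 𝟙 ((R ∧ r) ∧ Rev) - sign es * 𝟙 (R ∧ Rev)
      ≡⟨ factor (sign es) (𝟙 ((R ∧ r) ∧ Rev)) (𝟙 (R ∧ Rev)) ⟩
    sign es * (𝟙 ((R ∧ r) ∧ Rev) - 𝟙 (R ∧ Rev))
      ≡⟨ cong (sign es *_) (𝟙-drop R r Rev) ⟩
    sign es * - 𝟙 (R ∧ (not r ∧ Rev))
      ≡⟨ neg-out (sign es) (𝟙 (R ∧ (not r ∧ Rev))) ⟩
    - sign es * 𝟙 (R ∧ (not r ∧ Rev)) ∎
    where
    open ≡-Reasoning
    e∉es = All¬⇒¬Any e≢
    Rev = allReversed es w
    R  = respects (G ∖∖ (e ∷ es)) w
    r  = respects (single e) w
    R₀ = respects (G ∖∖ es) w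
    R₁ = respects (G ∖ e ∖∖ es) w
    R₀≡ : R₀ ≡ R ∧ r
    R₀≡ = respects-union (∖∖-restore G e∈G e∉es) w
    R₁≡ : R₁ ≡ R
    R₁≡ = sym (respects-≈ (∖∖-∷ G e es) w)
    factor : ∀ s p q → s * p - s * q ≡ s * (p - q)
    factor = solve 3 (λ s p q → s :* p :- s :* q := s :* (p :- q)) refl
    neg-out : ∀ s p → s * - p ≡ - s * p
    neg-out = solve 2 (λ s p → s :* :- p := :- s :* p) refl
    𝟙-drop : ∀ a b c → 𝟙 ((a ∧ b) ∧ c) - 𝟙 (a ∧ c) ≡ - 𝟙 (a ∧ (not b ∧ c))
    𝟙-drop true  true  true  = refl
    𝟙-drop true  true  false = refl
    𝟙-drop true  false true  = refl
    𝟙-drop true  false false = refl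
    𝟙-drop false b     c     = refl

altSum : ∀ {n} → Graph n → List (Edge n) → (Fin n → ℚ) → ℚ
altSum {n} G es x = ∑[ w ← words n ] alt G es w * wordTerm x w

altSum-∷ : ∀ {n} (G : Graph n) e es x → altSum G (e ∷ es) x ≡ altSum G es x - altSum (G ∖ e) es x
altSum-∷ {n} G e es x =
  trans (∑-cong {xs = words n} λ {w} _ → distrib (alt G es w) (alt (G ∖ e) es w) (wordTerm x w))
        (∑-- (words n) (λ w → alt G es w * wordTerm x w) (λ w → alt (G ∖ e) es w * wordTerm x w))
  where
  distrib : ∀ p q t → (p - q) * t ≡ p * t - q * t
  distrib = solve 3 (λ p q t → (p :- q) :* t := p :* t :- q :* t) refl

difference : ∀ {n} → Fin n → Fin n → Poly n
difference a b = var a ⊕ (con (- 1ℚ) ⊗ var b)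

eval-difference : ∀ {n} (a b : Fin n) x → eval (difference a b) x ≡ x a - x b
eval-difference a b x = lemma (x a) (x b)
  where
  lemma : ∀ p q → p + - 1ℚ * q ≡ p - q
  lemma = solve 2 (λ p q → p :+ :- con 1ℚ :* q := p :- q) refl

PolyVanishBelow : ∀ {n} → Graph n → Set
PolyVanishBelow {n} G = ∀ (H : Graph n) → edgeCount H < edgeCount G → PolyVanish H (N′ H)

inclusion-exclusion : ∀ {n} (G : Graph n) → PolyVanishBelow G → ∀ es → Unique es → All (_∈ᴳ G) es →
                      PolyVanish G (λ x → edgeProd′ G x * (altSum G es x - Ψ′ G x))
inclusion-exclusion G smaller [] _ _ = zero-polyVanish λ x _ → e*[p-p]≡0 (edgeProd′ G x) (Ψ′ G x)
  where
  e*[p-p]≡0 : ∀ e p → e * (p - p) ≡ 0ℚ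
  e*[p-p]≡0 = solve 2 (λ e p → e :* (p :- p) := con 0ℚ) refl
inclusion-exclusion G smaller (e@(a , b) ∷ es) (e≢ ∷ u) (e∈G ∷ es⊆G) =
  polyVanish-cong combine
    (polyVanish-+ (inclusion-exclusion G smaller es u es⊆G)
      (polyVanish-* (difference b a) (polyVanish-⊆ (∖-⊆ G e)
        (polyVanish-+ (inclusion-exclusion G′ smaller′ es u es⊆G′) (smaller G′ G′<G)))))
  where
  G′ = G ∖ e
  G′<G = edgeCount-∖ G e∈G
  smaller′ : PolyVanishBelow G′
  smaller′ H H<G′ = smaller H (ℕₚ.<-trans H<G′ G′<G)
  es⊆G′ = All.zipWith (λ (e≢f , f∈G) → ∖-keeps G (e≢f ∘ sym) f∈G) (e≢ , es⊆G)
  combine : ∀ x → Distinct x →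
    edgeProd′ G x * (altSum G es x - Ψ′ G x) +
      eval (difference b a) x * (edgeProd′ G′ x * (altSum G′ es x - Ψ′ G′ x) + N′ G′ x)
    ≡ edgeProd′ G x * (altSum G (e ∷ es) x - Ψ′ G x)
  combine x _ = begin
    E * (A - P) + eval (difference b a) x * (E′ * (A′ - P′) + P′ * E′)
      ≡⟨ cong (λ d → E * (A - P) + d * (E′ * (A′ - P′) + P′ * E′)) (eval-difference b a x) ⟩
    E * (A - P) + (x b - x a) * (E′ * (A′ - P′) + P′ * E′)
      ≡⟨ collapse E E′ A A′ P P′ (x a) (x b) ⟩
    E * (A - P) - ((x a - x b) * E′) * A′
      ≡⟨ cong (λ t → E * (A - P) - t * A′) (edgeProd′-∖ x G e∈G) ⟨
    E * (A - P) - E * A′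
      ≡⟨ regroup E A A′ P ⟩
    E * ((A - A′) - P)
      ≡⟨ cong (λ t → E * (t - P)) (altSum-∷ G e es x) ⟨
    E * (altSum G (e ∷ es) x - P) ∎
    where
    open ≡-Reasoning
    E = edgeProd′ G x
    E′ = edgeProd′ G′ x
    A = altSum G es x
    A′ = altSum G′ es x
    P = Ψ′ G x
    P′ = Ψ′ G′ x
    collapse : ∀ E E′ A A′ P P′ xa xb →
               E * (A - P) + (xb - xa) * (E′ * (A′ - P′) + P′ * E′) ≡ E * (A - P) - ((xa - xb) * E′) * A′
    collapse = solve 8 (λ E E′ A A′ P P′ xa xb →
                 E :* (A :- P) :+ (xb :- xa) :* (E′ :* (A′ :- P′) :+ P′ :* E′) := E :* (A :- P) :- ((xa :- xb) :* E′) :* A′) refl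
    regroup : ∀ E A A′ P → E * (A - P) - E * A′ ≡ E * ((A - A′) - P)
    regroup = solve 4 (λ E A A′ P → E :* (A :- P) :- E :* A′ := E :* ((A :- A′) :- P)) refl

module Cycle {n : ℕ} (G : Graph n) (loopless : ∀ v → edge G v v ≡ false) {a b : Fin n} (ab : edge G a b ≡ true)
             {vs : List (Fin n)} (p : SimplePath (G ∖ (a , b)) a b vs) where

  cycleArcs : List (Edge n)
  cycleArcs = (a , b) ∷ backwardArcs p

  ab∉backward : (a , b) ∉ backwardArcs p
  ab∉backward ab∈ = ∖-≢ G (backwardArcs-⊆ p ab∈) refl

  cycleArcs-unique : Unique cycleArcs
  cycleArcs-unique = ¬Any⇒All¬ _ ab∉backward ∷ backwardArcs-unique p

  cycleArcs-⊆ : All (_∈ᴳ G) cycleArcs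
  cycleArcs-⊆ = ab ∷ All.tabulate λ e∈ → ⊆-edge (∖-⊆ G (a , b)) (backwardArcs-⊆ p e∈)

  forward∉cycle : ∀ {e} → e ∈ forwardArcs p → e ∉ cycleArcs
  forward∉cycle e∈ (here e≡ab) = ∖-≢ G (forwardArcs-⊆ p e∈) e≡ab
  forward∉cycle e∈ (there e∈′) = forward∉backward p e∈ e∈′

  -- Keeping the forward arcs of p and reversing the cycle arcs makes the cycle directed: positions
  -- in w would increase strictly all the way round it.
  no-arrangement-reverses-cycle : ∀ {w} → Arrangement w →
                                  respects (G ∖∖ cycleArcs) w ∧ allReversed cycleArcs w ≡ false
  no-arrangement-reverses-cycle {w} (u , w∋) = ≢true⇒≡false λ both →
    let kept , reversed = ∧-true⁻ (respects (G ∖∖ cycleArcs) w) both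
        backwards : ∀ {e} → e ∈ cycleArcs → position (proj₂ e) w < position (proj₁ e) w
        backwards {c , d} e∈ = single⇒< u (w∋ d) (w∋ c)
          (not-false⁻ (trans (sym (single-flip u (w∋ c) (w∋ d) (loopless-≢ (All.lookup cycleArcs-⊆ e∈))))
                             (not-true⁻ (allB-∈ reversed e∈))))
        forwards : ∀ {e} → e ∈ forwardArcs p → position (proj₁ e) w < position (proj₂ e) w
        forwards {c , d} e∈ = respects⇒< (G ∖∖ cycleArcs) u kept (kept-arc e∈) (w∋ c) (w∋ d)
    in ℕₚ.<⇒≱ (backwards (here refl)) (position-along p w forwards (backwards ∘ there))
    where
    loopless-≢ : ∀ {c d} → edge G c d ≡ true → c ≢ d
    loopless-≢ {c} cd refl = true≢false (trans (sym cd) (loopless c))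
    kept-arc : ∀ {c d} → (c , d) ∈ forwardArcs p → edge (G ∖∖ cycleArcs) c d ≡ true
    kept-arc {c} {d} cd∈ rewrite dec-false (any? ((c , d) ≟ₑ_) cycleArcs) (forward∉cycle cd∈) =
      ⊆-edge (∖-⊆ G (a , b)) (forwardArcs-⊆ p cd∈)

  altSum-cycle : ∀ x → altSum G cycleArcs x ≡ 0ℚ
  altSum-cycle x = ∑-zero λ {w} w∈ → begin
    alt G cycleArcs w * wordTerm x w
      ≡⟨ cong (_* wordTerm x w) (alt-closed-form G cycleArcs w cycleArcs-unique cycleArcs-⊆) ⟩
    sign cycleArcs * 𝟙 (respects (G ∖∖ cycleArcs) w ∧ allReversed cycleArcs w) * wordTerm x w
      ≡⟨ cong (λ t → sign cycleArcs * 𝟙 t * wordTerm x w) (no-arrangement-reverses-cycle (words-arrangement w∈)) ⟩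
    sign cycleArcs * 0ℚ * wordTerm x w
      ≡⟨ s*0*t≡0 (sign cycleArcs) (wordTerm x w) ⟩
    0ℚ ∎
    where
    open ≡-Reasoning
    s*0*t≡0 : ∀ s t → s * 0ℚ * t ≡ 0ℚ
    s*0*t≡0 = solve 2 (λ s t → s :* con 0ℚ :* t := con 0ℚ) refl

  N′-polyVanish : PolyVanishBelow G → PolyVanish G (N′ G)
  N′-polyVanish smaller =
    polyVanish-cong N′≡ (polyVanish-* (con (- 1ℚ)) (inclusion-exclusion G smaller cycleArcs cycleArcs-unique cycleArcs-⊆))
    where
    N′≡ : ∀ x → Distinct x → - 1ℚ * (edgeProd′ G x * (altSum G cycleArcs x - Ψ′ G x)) ≡ N′ G x
    N′≡ x _ = trans (cong (λ t → - 1ℚ * (edgeProd′ G x * (t - Ψ′ G x))) (altSum-cycle x))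
                    (lemma (edgeProd′ G x) (Ψ′ G x))
      where
      lemma : ∀ e p → - 1ℚ * (e * (0ℚ - p)) ≡ p * e
      lemma = solve 2 (λ e p → :- con 1ℚ :* (e :* (con 0ℚ :- p)) := p :* e) refl

-- Reversals and forks

module _ {n : ℕ} (G : Graph n) where

  -- On arrangements, 𝟙[a before b] = 1 - 𝟙[b before a].
  𝟙-reverse : ∀ {a b} → a ≢ b → edge G a b ≡ true → ∀ {w} → Arrangement w →
              𝟙 (respects G w) ≡ 𝟙 (respects (G ∖ (a , b)) w) - 𝟙 (respects (G ∖ (a , b) ∪ (b , a)) w)
  𝟙-reverse {a} {b} a≢b ab {w} (u , w∋) = begin
    𝟙 (respects G w)
      ≡⟨ cong 𝟙 (respects-∖ G ab w) ⟩
    𝟙 (respects G₁ w ∧ respects (single (a , b)) w)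
      ≡⟨ cong (λ s → 𝟙 (respects G₁ w ∧ s)) (single-flip u (w∋ a) (w∋ b) a≢b) ⟩
    𝟙 (respects G₁ w ∧ not (respects (single (b , a)) w))
      ≡⟨ 𝟙-∧-not (respects G₁ w) (respects (single (b , a)) w) ⟩
    𝟙 (respects G₁ w) - 𝟙 (respects G₁ w ∧ respects (single (b , a)) w)
      ≡⟨ cong (λ s → 𝟙 (respects G₁ w) - 𝟙 s) (respects-∪ G₁ (b , a) w) ⟨
    𝟙 (respects G₁ w) - 𝟙 (respects (G₁ ∪ (b , a)) w) ∎
    where
    open ≡-Reasoning
    G₁ = G ∖ (a , b)
    𝟙-∧-not : ∀ r s → 𝟙 (r ∧ not s) ≡ 𝟙 r - 𝟙 (r ∧ s)
    𝟙-∧-not true  true  = refl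
    𝟙-∧-not true  false = refl
    𝟙-∧-not false s     = refl

  -- On arrangements, 𝟙[o<p] 𝟙[o<q] = 𝟙[o<p] 𝟙[p<q] + 𝟙[o<q] 𝟙[q<p].
  𝟙-fork : ∀ {o p q} → p ≢ q → edge G o p ≡ true → edge G o q ≡ true → ∀ {w} → Arrangement w →
           𝟙 (respects G w) ≡ 𝟙 (respects (G ∖ (o , q) ∪ (p , q)) w) + 𝟙 (respects (G ∖ (o , p) ∪ (q , p)) w)
  𝟙-fork {o} {p} {q} p≢q op oq {w} (u , w∋) = begin
    𝟙 (respects G w)
      ≡⟨ cong 𝟙 (trans (respects-∖ G op w) (cong (_∧ o<p) resp-Gₚ)) ⟩
    𝟙 ((R ∧ o<q) ∧ o<p)
      ≡⟨ 𝟙-split R o<p o<q p<q o<p⇒p<q⇒o<q o<q⇒q<p⇒o<p ⟩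
    𝟙 ((R ∧ o<p) ∧ p<q) + 𝟙 ((R ∧ o<q) ∧ not p<q)
      ≡⟨ cong₂ (λ s t → 𝟙 s + 𝟙 ((R ∧ o<q) ∧ t)) resp-G₁ (single-flip u (w∋ q) (w∋ p) (p≢q ∘ sym)) ⟨
    𝟙 (respects G₁ w) + 𝟙 ((R ∧ o<q) ∧ q<p)
      ≡⟨ cong (λ s → 𝟙 (respects G₁ w) + 𝟙 s) resp-G₂ ⟨
    𝟙 (respects G₁ w) + 𝟙 (respects G₂ w) ∎
    where
    open ≡-Reasoning
    Gₚ  = G ∖ (o , p)
    G_q = G ∖ (o , q)
    G₁  = G_q ∪ (p , q)
    G₂  = Gₚ ∪ (q , p)
    R   = respects (Gₚ ∖ (o , q)) w
    o<p = respects (single (o , p)) w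
    o<q = respects (single (o , q)) w
    p<q = respects (single (p , q)) w
    q<p = respects (single (q , p)) w
    resp-Gₚ : respects Gₚ w ≡ R ∧ o<q
    resp-Gₚ = respects-∖ Gₚ (∖-keeps G (p≢q ∘ sym ∘ cong proj₂) oq) w
    resp-G₁ : respects G₁ w ≡ (R ∧ o<p) ∧ p<q
    resp-G₁ = trans (respects-∪ G_q (p , q) w)
                    (cong (_∧ p<q) (trans (respects-∖ G_q (∖-keeps G (p≢q ∘ cong proj₂) op) w)
                                          (cong (_∧ o<p) (respects-≈ (∖-comm G (o , q) (o , p)) w))))
    resp-G₂ : respects G₂ w ≡ (R ∧ o<q) ∧ q<p
    resp-G₂ = trans (respects-∪ Gₚ (q , p) w) (cong (_∧ q<p) resp-Gₚ)
    o<p⇒p<q⇒o<q : o<p ≡ true → p<q ≡ true → o<q ≡ true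
    o<p⇒p<q⇒o<q o<p p<q = <⇒single u (w∋ o) (w∋ q)
      (ℕₚ.<-trans (single⇒< u (w∋ o) (w∋ p) o<p) (single⇒< u (w∋ p) (w∋ q) p<q))
    o<q⇒q<p⇒o<p : o<q ≡ true → p<q ≡ false → o<p ≡ true
    o<q⇒q<p⇒o<p o<q p≮q = <⇒single u (w∋ o) (w∋ p)
      (ℕₚ.<-trans (single⇒< u (w∋ o) (w∋ q) o<q)
                  (single⇒< u (w∋ q) (w∋ p) (not-false⁻ (trans (sym (single-flip u (w∋ p) (w∋ q) p≢q)) p≮q))))
    𝟙-split : ∀ r a b c → (a ≡ true → c ≡ true → b ≡ true) → (b ≡ true → c ≡ false → a ≡ true) →
              𝟙 ((r ∧ b) ∧ a) ≡ 𝟙 ((r ∧ a) ∧ c) + 𝟙 ((r ∧ b) ∧ not c)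
    𝟙-split false a     b     c     _  _  = refl
    𝟙-split true  true  true  true  _  _  = refl
    𝟙-split true  true  true  false _  _  = refl
    𝟙-split true  true  false true  h₁ _  with () ← h₁ refl refl
    𝟙-split true  true  false false _  _  = refl
    𝟙-split true  false true  true  _  _  = refl
    𝟙-split true  false true  false _  h₂ with () ← h₂ refl refl
    𝟙-split true  false false true  _  _  = refl
    𝟙-split true  false false false _  _  = refl

module _ {n : ℕ} (x : Fin n → ℚ) where

  Ψ′-difference : ∀ (G G₁ G₂ : Graph n) →
                  (∀ {w} → Arrangement w → 𝟙 (respects G w) ≡ 𝟙 (respects G₁ w) - 𝟙 (respects G₂ w)) →
                  Ψ′ G x ≡ Ψ′ G₁ x - Ψ′ G₂ x
  Ψ′-difference G G₁ G₂ 𝟙≡ =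
    trans (∑-cong λ {w} w∈ → trans (cong (_* wordTerm x w) (𝟙≡ (words-arrangement w∈)))
                                   (distrib (𝟙 (respects G₁ w)) (𝟙 (respects G₂ w)) (wordTerm x w)))
          (∑-- (words n) _ _)
    where
    distrib : ∀ p q t → (p - q) * t ≡ p * t - q * t
    distrib = solve 3 (λ p q t → (p :- q) :* t := p :* t :- q :* t) refl

  Ψ′-sum : ∀ (G G₁ G₂ : Graph n) →
           (∀ {w} → Arrangement w → 𝟙 (respects G w) ≡ 𝟙 (respects G₁ w) + 𝟙 (respects G₂ w)) →
           Ψ′ G x ≡ Ψ′ G₁ x + Ψ′ G₂ x
  Ψ′-sum G G₁ G₂ 𝟙≡ =
    trans (∑-cong λ {w} w∈ → trans (cong (_* wordTerm x w) (𝟙≡ (words-arrangement w∈)))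
                                   (*-distribʳ-+ (wordTerm x w) (𝟙 (respects G₁ w)) (𝟙 (respects G₂ w))))
          (∑-+ (words n) _ _)

  N′-reverse : ∀ (G : Graph n) {a b} → a ≢ b → edge G a b ≡ true → edge G b a ≡ false →
               N′ G x ≡ (x a - x b) * N′ (G ∖ (a , b)) x + N′ (G ∖ (a , b) ∪ (b , a)) x
  N′-reverse G {a} {b} a≢b ab ba≡false = begin
    Ψ′ G x * edgeProd′ G x
      ≡⟨ cong₂ _*_ (Ψ′-difference G G₁ G₂ (𝟙-reverse G a≢b ab)) (edgeProd′-∖ x G ab) ⟩
    (Ψ′ G₁ x - Ψ′ G₂ x) * ((x a - x b) * E₁)
      ≡⟨ regroup (Ψ′ G₁ x) (Ψ′ G₂ x) (x a) (x b) E₁ ⟩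
    (x a - x b) * (Ψ′ G₁ x * E₁) + Ψ′ G₂ x * ((x b - x a) * E₁)
      ≡⟨ cong (λ t → (x a - x b) * (Ψ′ G₁ x * E₁) + Ψ′ G₂ x * t) (edgeProd′-∪ x G₁ ba∉G₁) ⟨
    (x a - x b) * N′ G₁ x + N′ G₂ x ∎
    where
    open ≡-Reasoning
    G₁ = G ∖ (a , b)
    G₂ = G₁ ∪ (b , a)
    E₁ = edgeProd′ G₁ x
    ba∉G₁ : edge G₁ b a ≡ false
    ba∉G₁ = trans (∖-other G (a≢b ∘ sym ∘ cong proj₁)) ba≡false
    regroup : ∀ p q a b e → (p - q) * ((a - b) * e) ≡ (a - b) * (p * e) + q * ((b - a) * e)
    regroup = solve 5 (λ p q a b e → (p :- q) :* ((a :- b) :* e) := (a :- b) :* (p :* e) :+ q :* ((b :- a) :* e)) refl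

  N′-fork : ∀ (G : Graph n) {o p q} → p ≢ q → edge G o p ≡ true → edge G o q ≡ true →
            edge G p q ≡ false → edge G q p ≡ false →
            (x p - x q) * N′ G x ≡
              (x o - x q) * N′ (G ∖ (o , q) ∪ (p , q)) x - (x o - x p) * N′ (G ∖ (o , p) ∪ (q , p)) x
  N′-fork G {o} {p} {q} p≢q op oq pq≡false qp≡false = begin
    (x p - x q) * (Ψ′ G x * edgeProd′ G x)
      ≡⟨ cong₂ (λ s t → (x p - x q) * (s * t)) (Ψ′-sum G G₁ G₂ (𝟙-fork G p≢q op oq)) E-G ⟩
    (x p - x q) * ((Ψ₁ + Ψ₂) * ((x o - x p) * ((x o - x q) * E)))
      ≡⟨ distribute Ψ₁ Ψ₂ (x o) (x p) (x q) E ⟩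
    (x o - x q) * (Ψ₁ * ((x p - x q) * ((x o - x p) * E))) - (x o - x p) * (Ψ₂ * ((x q - x p) * ((x o - x q) * E)))
      ≡⟨ cong₂ (λ s t → (x o - x q) * (Ψ₁ * s) - (x o - x p) * (Ψ₂ * t)) E-G₁ E-G₂ ⟨
    (x o - x q) * N′ G₁ x - (x o - x p) * N′ G₂ x ∎
    where
    open ≡-Reasoning
    Gₚ = G ∖ (o , p)
    G_q = G ∖ (o , q)
    G₁ = G_q ∪ (p , q)
    G₂ = Gₚ ∪ (q , p)
    K  = Gₚ ∖ (o , q)
    E  = edgeProd′ K x
    Ψ₁ = Ψ′ G₁ x
    Ψ₂ = Ψ′ G₂ x
    oq∈Gₚ : edge Gₚ o q ≡ true
    oq∈Gₚ = ∖-keeps G (p≢q ∘ sym ∘ cong proj₂) oq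
    op∈G_q : edge G_q o p ≡ true
    op∈G_q = ∖-keeps G (p≢q ∘ cong proj₂) op
    E-Gₚ : edgeProd′ Gₚ x ≡ (x o - x q) * E
    E-Gₚ = edgeProd′-∖ x Gₚ oq∈Gₚ
    E-G : edgeProd′ G x ≡ (x o - x p) * ((x o - x q) * E)
    E-G = trans (edgeProd′-∖ x G op) (cong ((x o - x p) *_) E-Gₚ)
    E-G₁ : edgeProd′ G₁ x ≡ (x p - x q) * ((x o - x p) * E)
    E-G₁ = trans (edgeProd′-∪ x G_q (∖-absent G pq≡false))
                 (cong ((x p - x q) *_) (trans (edgeProd′-∖ x G_q op∈G_q)
                                               (cong ((x o - x p) *_) (edgeProd′-≈ x (∖-comm G (o , q) (o , p))))))
    E-G₂ : edgeProd′ G₂ x ≡ (x q - x p) * ((x o - x q) * E)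
    E-G₂ = trans (edgeProd′-∪ x Gₚ (∖-absent G qp≡false)) (cong ((x q - x p) *_) E-Gₚ)
    distribute : ∀ Ψ₁ Ψ₂ o p q E →
      (p - q) * ((Ψ₁ + Ψ₂) * ((o - p) * ((o - q) * E))) ≡
        (o - q) * (Ψ₁ * ((p - q) * ((o - p) * E))) - (o - p) * (Ψ₂ * ((q - p) * ((o - q) * E)))
    distribute = solve 6 (λ Ψ₁ Ψ₂ o p q E →
                   (p :- q) :* ((Ψ₁ :+ Ψ₂) :* ((o :- p) :* ((o :- q) :* E))) :=
                   (o :- q) :* (Ψ₁ :* ((p :- q) :* ((o :- p) :* E))) :- (o :- p) :* (Ψ₂ :* ((q :- p) :* ((o :- q) :* E)))) refl

-- Removing vertex zero

insertions-map : ∀ {A B : Set} (f : A → B) z u → insertions (f z) (map f u) ≡ map (map f) (insertions z u)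
insertions-map f z []       = refl
insertions-map f z (c ∷ cs) = cong ((f z ∷ f c ∷ map f cs) ∷_) (begin
  map (f c ∷_) (insertions (f z) (map f cs))    ≡⟨ cong (map (f c ∷_)) (insertions-map f z cs) ⟩
  map (f c ∷_) (map (map f) (insertions z cs))  ≡⟨ Listₚ.map-∘ (insertions z cs) ⟨
  map (map f ∘ (c ∷_)) (insertions z cs)        ≡⟨ Listₚ.map-∘ (insertions z cs) ⟩
  map (map f) (map (c ∷_) (insertions z cs))    ∎)
  where open ≡-Reasoning

permutations-map : ∀ {A B : Set} (f : A → B) l → permutations (map f l) ≡ map (map f) (permutations l)
permutations-map f []      = refl
permutations-map f (z ∷ l) = begin
  concatMap (insertions (f z)) (permutations (map f l))       ≡⟨ cong (concatMap (insertions (f z))) (permutations-map f l) ⟩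
  concatMap (insertions (f z)) (map (map f) (permutations l)) ≡⟨ Listₚ.concatMap-map (insertions (f z)) (map f) (permutations l) ⟩
  concatMap (insertions (f z) ∘ map f) (permutations l)       ≡⟨ concatMap-cong (insertions-map f z) (permutations l) ⟩
  concatMap (map (map f) ∘ insertions z) (permutations l)     ≡⟨ Listₚ.map-concatMap (map f) (insertions z) (permutations l) ⟨
  map (map f) (concatMap (insertions z) (permutations l))     ∎
  where open ≡-Reasoning

∑-words-suc : ∀ m (h : List (Fin (suc m)) → ℚ) →
              ∑ (words (suc m)) h ≡ ∑[ w ← words m ] ∑ (insertions zero (map suc w)) h
∑-words-suc m h = begin
  ∑ (concatMap (insertions zero) (permutations (tabulate suc))) h
    ≡⟨ cong (λ l → ∑ (concatMap (insertions zero) (permutations l)) h) (Listₚ.map-tabulate (λ i → i) suc) ⟨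
  ∑ (concatMap (insertions zero) (permutations (map suc (allFin m)))) h
    ≡⟨ cong (λ l → ∑ (concatMap (insertions zero) l) h) (permutations-map suc (allFin m)) ⟩
  ∑ (concatMap (insertions zero) (map (map suc) (words m))) h
    ≡⟨ ∑-concatMap (insertions zero) (map (map suc) (words m)) h ⟩
  ∑[ w ← map (map suc) (words m) ] ∑ (insertions zero w) h
    ≡⟨ ∑-map (map suc) (words m) (λ w → ∑ (insertions zero w) h) ⟩
  ∑[ w ← words m ] ∑ (insertions zero (map suc w)) h ∎
  where open ≡-Reasoning

wordTerm-map : ∀ {m k} (x : Fin k → ℚ) (f : Fin m → Fin k) w → wordTerm x (map f w) ≡ wordTerm (x ∘ f) w
wordTerm-map x f []           = refl
wordTerm-map x f (a ∷ [])     = refl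
wordTerm-map x f (a ∷ b ∷ ws) = cong (inv (x (f a) - x (f b)) *_) (wordTerm-map x f (b ∷ ws))

module _ {A : Set} where

  ∈-insertions : ∀ (z : A) u {v} → v ∈ insertions z u → z ∈ v
  ∈-insertions z u v∈ = ∈-resp-↭ (↭-sym (insertions-↭ z u v∈)) (here refl)

  allB-insertions : ∀ (q : A → Bool) z u → q z ≡ true → ∀ {v} → v ∈ insertions z u → allB q v ≡ allB q u
  allB-insertions q z []       qz (here refl) = cong (_∧ true) qz
  allB-insertions q z (c ∷ cs) qz (here refl) = cong (_∧ (q c ∧ allB q cs)) qz
  allB-insertions q z (c ∷ cs) qz (there v∈) with ∈-map⁻ (c ∷_) v∈
  ... | v , v∈′ , refl = cong (q c ∧_) (allB-insertions q z cs qz v∈′)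

respects-insertions : ∀ {n} (H : Graph n) z → (∀ y → edge H z y ≡ false) → (∀ y → edge H y z ≡ false) →
                      ∀ u {v} → v ∈ insertions z u → respects H v ≡ respects H u
respects-insertions H z out in′ []       (here refl) rewrite out z = refl
respects-insertions H z out in′ (c ∷ cs) (here refl) rewrite out z | in′ c =
  cong (_∧ respects H (c ∷ cs)) (allB-true {xs = cs} λ {y} _ → cong not (in′ y))
respects-insertions H z out in′ (c ∷ cs) (there v∈) with ∈-map⁻ (c ∷_) v∈
... | v , v∈′ , refl =
  cong (not (edge H c c) ∧_) (cong₂ _∧_ (allB-insertions (λ b → not (edge H b c)) z cs (cong not (out c)) v∈′)
                                       (respects-insertions H z out in′ cs v∈′))

absorb : ∀ α β γ δ T → α * β ≡ γ * (α + β) → β + δ ≡ 0ℚ → α * (β * T) + γ * (T * δ) ≡ γ * T * α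
absorb α β γ δ T αβ β+δ = begin
  α * (β * T) + γ * (T * δ)       ≡⟨ regroup₁ α β γ δ T ⟩
  (α * β) * T + γ * T * δ         ≡⟨ cong (λ t → t * T + γ * T * δ) αβ ⟩
  γ * (α + β) * T + γ * T * δ     ≡⟨ regroup₂ α β γ δ T ⟩
  γ * T * α + γ * T * (β + δ)     ≡⟨ cong (λ t → γ * T * α + γ * T * t) β+δ ⟩
  γ * T * α + γ * T * 0ℚ          ≡⟨ drop-zero (γ * T * α) (γ * T) ⟩
  γ * T * α                       ∎
  where
  open ≡-Reasoning
  regroup₁ : ∀ α β γ δ T → α * (β * T) + γ * (T * δ) ≡ (α * β) * T + γ * T * δ
  regroup₁ = solve 5 (λ α β γ δ T → α :* (β :* T) :+ γ :* (T :* δ) := (α :* β) :* T :+ γ :* T :* δ) refl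
  regroup₂ : ∀ α β γ δ T → γ * (α + β) * T + γ * T * δ ≡ γ * T * α + γ * T * (β + δ)
  regroup₂ = solve 5 (λ α β γ δ T → γ :* (α :+ β) :* T :+ γ :* T :* δ := γ :* T :* α :+ γ :* T :* (β :+ δ)) refl
  drop-zero : ∀ s t → s + t * 0ℚ ≡ s
  drop-zero = solve 2 (λ s t → s :+ t :* con 0ℚ := s) refl

module InsertionSums {k : ℕ} (X : Fin k → ℚ) (distinct : Distinct X) where

  wt : List (Fin k) → ℚ
  wt = wordTerm X

  ι : Fin k → Fin k → ℚ
  ι a b = inv (X a - X b)

  ι-antisym : ∀ a b → ι a b + ι b a ≡ 0ℚ
  ι-antisym a b = inv-diff-antisym (X a) (X b)

  ι-chain : ∀ {a b c} → a ≢ b → b ≢ c → a ≢ c → ι a b * ι b c ≡ ι a c * (ι a b + ι b c)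
  ι-chain a≢b b≢c a≢c = inv-diff-chain (a≢b ∘ distinct) (b≢c ∘ distinct) (a≢c ∘ distinct)

  private
    head-≢ : ∀ {z c : Fin k} {ws} → Unique (z ∷ c ∷ ws) → z ≢ c
    head-≢ ((z≢c ∷ _) ∷ _) = z≢c

    z∉tail : ∀ {z c : Fin k} {ws} → Unique (z ∷ c ∷ ws) → z ∉ ws
    z∉tail ((_ ∷ z≢ws) ∷ _) = All¬⇒¬Any z≢ws

    c∉tail : ∀ {z c : Fin k} {ws} → Unique (z ∷ c ∷ ws) → c ∉ ws
    c∉tail (_ ∷ c≢ws ∷ _) = All¬⇒¬Any c≢ws

    drop-second : ∀ {z c : Fin k} {ws} → Unique (z ∷ c ∷ ws) → Unique (z ∷ ws)
    drop-second ((_ ∷ z≢ws) ∷ _ ∷ u) = z≢ws ∷ u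

  ∑-insertions-after : ∀ z c ws → Unique (z ∷ c ∷ ws) → ∑[ v ← insertions z ws ] wt (c ∷ v) ≡ wt (c ∷ ws) * ι c z
  ∑-insertions-after z c []       u = lemma (ι c z)
    where
    lemma : ∀ a → a * 1ℚ + 0ℚ ≡ 1ℚ * a
    lemma = solve 1 (λ a → a :* con 1ℚ :+ con 0ℚ := con 1ℚ :* a) refl
  ∑-insertions-after z c (d ∷ ds) u = begin
    wt (c ∷ z ∷ d ∷ ds) + (∑[ v ← map (d ∷_) (insertions z ds) ] wt (c ∷ v))
      ≡⟨ cong (wt (c ∷ z ∷ d ∷ ds) +_) (trans (∑-map (d ∷_) (insertions z ds) (λ v → wt (c ∷ v)))
                                              (∑-*ˡ (ι c d) (insertions z ds) (λ v → wt (d ∷ v)))) ⟩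
    ι c z * (ι z d * wt (d ∷ ds)) + ι c d * (∑[ v ← insertions z ds ] wt (d ∷ v))
      ≡⟨ cong (λ t → ι c z * (ι z d * wt (d ∷ ds)) + ι c d * t) (∑-insertions-after z d ds (drop-second u)) ⟩
    ι c z * (ι z d * wt (d ∷ ds)) + ι c d * (wt (d ∷ ds) * ι d z)
      ≡⟨ absorb (ι c z) (ι z d) (ι c d) (ι d z) (wt (d ∷ ds))
                (ι-chain (head-≢ u ∘ sym) (head-≢ (drop-second u)) (c∉tail u ∘ here)) (ι-antisym z d) ⟩
    ι c d * wt (d ∷ ds) * ι c z ∎
    where open ≡-Reasoning

  ∑-insertions : ∀ z c ws → Unique (z ∷ c ∷ ws) → ∑[ v ← insertions z (c ∷ ws) ] wt v ≡ 0ℚ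
  ∑-insertions z c ws u = begin
    wt (z ∷ c ∷ ws) + (∑[ v ← map (c ∷_) (insertions z ws) ] wt v)
      ≡⟨ cong (wt (z ∷ c ∷ ws) +_) (trans (∑-map (c ∷_) (insertions z ws) wt) (∑-insertions-after z c ws u)) ⟩
    ι z c * wt (c ∷ ws) + wt (c ∷ ws) * ι c z
      ≡⟨ factor (ι z c) (ι c z) (wt (c ∷ ws)) ⟩
    wt (c ∷ ws) * (ι z c + ι c z)
      ≡⟨ cong (wt (c ∷ ws) *_) (ι-antisym z c) ⟩
    wt (c ∷ ws) * 0ℚ
      ≡⟨ *-zeroʳ (wt (c ∷ ws)) ⟩
    0ℚ ∎
    where
    open ≡-Reasoning
    factor : ∀ a b t → a * t + t * b ≡ t * (a + b)
    factor = solve 3 (λ a b t → a :* t :+ t :* b := t :* (a :+ b)) refl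

  ∑-insertions-after-target : ∀ z p (f : List (Fin k) → ℚ) ds →
    ∑[ v ← insertions z ds ] 𝟙 (respects (single (z , p)) (p ∷ v)) * f v ≡ 0ℚ
  ∑-insertions-after-target z p f ds = ∑-zero λ {v} v∈ →
    trans (cong (λ b → 𝟙 b * f v) (single-after {c = z} {p} (∈-insertions z ds v∈))) (*-zeroˡ (f v))

  module _ (z p : Fin k) where

    private
      S = single (z , p)

    ∑-insertions-before-after : ∀ c ws → Unique (z ∷ c ∷ ws) → p ∈ ws → c ≢ p →
      ∑[ v ← insertions z ws ] 𝟙 (respects S (c ∷ v)) * wt (c ∷ v) ≡ wt (c ∷ ws) * (ι c z + ι z p)
    ∑-insertions-before-after c (d ∷ ds) u p∈ c≢p = trans peel (by-cases (d Finₚ.≟ p) p∈)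
      where
      T    = wt (d ∷ ds)
      Rest = ∑[ v ← insertions z ds ] 𝟙 (respects S (d ∷ v)) * wt (d ∷ v)
      z≢p : z ≢ p
      z≢p refl = z∉tail u p∈
      peel : ∑[ v ← insertions z (d ∷ ds) ] 𝟙 (respects S (c ∷ v)) * wt (c ∷ v) ≡ ι c z * (ι z d * T) + ι c d * Rest
      peel = cong₂ _+_
        (trans (cong (λ b → 𝟙 b * wt (c ∷ z ∷ d ∷ ds)) (trans (single-skip (z ∷ d ∷ ds) c≢p) (single-head z≢p (z∉tail u))))
               (*-identityˡ (ι c z * (ι z d * T))))
        (trans (∑-map (d ∷_) (insertions z ds) (λ v → 𝟙 (respects S (c ∷ v)) * wt (c ∷ v)))
        (trans (∑-cong {xs = insertions z ds} λ {v} _ → trans (cong (λ b → 𝟙 b * wt (c ∷ d ∷ v)) (single-skip (d ∷ v) c≢p))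
                                       (swap (𝟙 (respects S (d ∷ v))) (ι c d) (wt (d ∷ v))))
               (∑-*ˡ (ι c d) (insertions z ds) (λ v → 𝟙 (respects S (d ∷ v)) * wt (d ∷ v)))))
        where
        swap : ∀ i g t → i * (g * t) ≡ g * (i * t)
        swap = solve 3 (λ i g t → i :* (g :* t) := g :* (i :* t)) refl
      by-cases : Dec (d ≡ p) → p ∈ d ∷ ds → ι c z * (ι z d * T) + ι c d * Rest ≡ wt (c ∷ d ∷ ds) * (ι c z + ι z p)
      by-cases (yes refl) _ = begin
        ι c z * (ι z d * T) + ι c d * Rest
          ≡⟨ cong (λ t → ι c z * (ι z d * T) + ι c d * t) (∑-insertions-after-target z d (λ v → wt (d ∷ v)) ds) ⟩
        ι c z * (ι z d * T) + ι c d * 0ℚ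
          ≡⟨ regroup (ι c z) (ι z d) (ι c d) T ⟩
        (ι c z * ι z d) * T
          ≡⟨ cong (_* T) (ι-chain (head-≢ u ∘ sym) z≢p c≢p) ⟩
        ι c d * (ι c z + ι z d) * T
          ≡⟨ reorder (ι c d) (ι c z + ι z d) T ⟩
        ι c d * T * (ι c z + ι z d) ∎
        where
        open ≡-Reasoning
        regroup : ∀ α β γ T → α * (β * T) + γ * 0ℚ ≡ (α * β) * T
        regroup = solve 4 (λ α β γ T → α :* (β :* T) :+ γ :* con 0ℚ := (α :* β) :* T) refl
        reorder : ∀ γ s T → γ * s * T ≡ γ * T * s
        reorder = solve 3 (λ γ s T → γ :* s :* T := γ :* T :* s) refl
      by-cases (no d≢p) (here p≡d)  = ⊥-elim (d≢p (sym p≡d))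
      by-cases (no d≢p) (there p∈′) = begin
        ι c z * (ι z d * T) + ι c d * Rest
          ≡⟨ cong (λ t → ι c z * (ι z d * T) + ι c d * t) (∑-insertions-before-after d ds (drop-second u) p∈′ d≢p) ⟩
        ι c z * (ι z d * T) + ι c d * (T * (ι d z + ι z p))
          ≡⟨ split (ι c z) (ι z d) (ι c d) (ι d z) (ι z p) T ⟩
        (ι c z * (ι z d * T) + ι c d * (T * ι d z)) + ι c d * T * ι z p
          ≡⟨ cong (_+ ι c d * T * ι z p)
                  (absorb (ι c z) (ι z d) (ι c d) (ι d z) T
                          (ι-chain (head-≢ u ∘ sym) (head-≢ (drop-second u)) (c∉tail u ∘ here)) (ι-antisym z d)) ⟩
        ι c d * T * ι c z + ι c d * T * ι z p
          ≡⟨ *-distribˡ-+ (ι c d * T) (ι c z) (ι z p) ⟨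
        ι c d * T * (ι c z + ι z p) ∎
        where
        open ≡-Reasoning
        split : ∀ α β γ δ π T → α * (β * T) + γ * (T * (δ + π)) ≡ (α * (β * T) + γ * (T * δ)) + γ * T * π
        split = solve 6 (λ α β γ δ π T →
                  α :* (β :* T) :+ γ :* (T :* (δ :+ π)) := (α :* (β :* T) :+ γ :* (T :* δ)) :+ γ :* T :* π) refl

    ∑-insertions-before : ∀ u → Unique (z ∷ u) → p ∈ u →
      ∑[ v ← insertions z u ] 𝟙 (respects S v) * wt v ≡ wt u * ι z p
    ∑-insertions-before (c ∷ ws) u p∈ = trans peel (by-cases (c Finₚ.≟ p) p∈)
      where
      T    = wt (c ∷ ws)
      Rest = ∑[ v ← insertions z ws ] 𝟙 (respects S (c ∷ v)) * wt (c ∷ v)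
      z∉ : z ∉ c ∷ ws
      z∉ = Unique[x∷xs]⇒x∉xs u
      peel : ∑[ v ← insertions z (c ∷ ws) ] 𝟙 (respects S v) * wt v ≡ ι z c * T + Rest
      peel = cong₂ _+_
        (trans (cong (λ b → 𝟙 b * wt (z ∷ c ∷ ws)) (single-head (λ { refl → z∉ p∈ }) z∉)) (*-identityˡ (ι z c * T)))
        (∑-map (c ∷_) (insertions z ws) (λ v → 𝟙 (respects S v) * wt v))
      by-cases : Dec (c ≡ p) → p ∈ c ∷ ws → ι z c * T + Rest ≡ T * ι z p
      by-cases (yes refl) _ =
        trans (cong (ι z c * T +_) (∑-insertions-after-target z c (λ v → wt (c ∷ v)) ws)) (lemma (ι z c) T)
        where
        lemma : ∀ a t → a * t + 0ℚ ≡ t * a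
        lemma = solve 2 (λ a t → a :* t :+ con 0ℚ := t :* a) refl
      by-cases (no c≢p) (here p≡c)  = ⊥-elim (c≢p (sym p≡c))
      by-cases (no c≢p) (there p∈′) = begin
        ι z c * T + Rest
          ≡⟨ cong (ι z c * T +_) (∑-insertions-before-after c ws u p∈′ c≢p) ⟩
        ι z c * T + T * (ι c z + ι z p)
          ≡⟨ regroup (ι z c) (ι c z) (ι z p) T ⟩
        T * (ι z c + ι c z) + T * ι z p
          ≡⟨ cong (λ s → T * s + T * ι z p) (ι-antisym z c) ⟩
        T * 0ℚ + T * ι z p
          ≡⟨ drop (T * ι z p) T ⟩
        T * ι z p ∎
        where
        open ≡-Reasoning
        regroup : ∀ a b π t → a * t + t * (b + π) ≡ t * (a + b) + t * π
        regroup = solve 4 (λ a b π t → a :* t :+ t :* (b :+ π) := t :* (a :+ b) :+ t :* π) refl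
        drop : ∀ s t → t * 0ℚ + s ≡ s
        drop = solve 2 (λ s t → t :* con 0ℚ :+ s := s) refl

unique-zero∷suc : ∀ {m} {w : List (Fin m)} → Unique w → Unique (zero ∷ map suc w)
unique-zero∷suc {w = w} u = ¬Any⇒All¬ _ zero∉ ∷ Uniqueₚ.map⁺ suc-injective u
  where
  zero∉ : zero ∉ map suc w
  zero∉ 0∈ with ∈-map⁻ suc 0∈
  ... | _ , _ , ()

module _ {m : ℕ} (G : Graph (suc m)) (out : ∀ v → edge G zero v ≡ false) (in′ : ∀ v → edge G v zero ≡ false) where

  edgeProd′-isolated : ∀ x → edgeProd′ G x ≡ edgeProd′ (comap suc G) (x ∘ suc)
  edgeProd′-isolated x = begin
    row zero * ∏ (row ∘ suc)
      ≡⟨ cong₂ _*_ row-zero (∏-cong row-suc) ⟩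
    1ℚ * edgeProd′ (comap suc G) (x ∘ suc)
      ≡⟨ *-identityˡ _ ⟩
    edgeProd′ (comap suc G) (x ∘ suc) ∎
    where
    open ≡-Reasoning
    row : Fin (suc m) → ℚ
    row u = ∏ λ v → arcFactor (edge G u v) (x u - x v)
    row-zero : row zero ≡ 1ℚ
    row-zero = trans (∏-cong λ v → cong (λ b → arcFactor b (x zero - x v)) (out v)) (∏-one (suc m))
    row-suc : ∀ u → row (suc u) ≡ ∏ λ v → arcFactor (edge G (suc u) (suc v)) (x (suc u) - x (suc v))
    row-suc u = trans (cong (λ b → arcFactor b (x (suc u) - x zero) * rest) (in′ (suc u))) (*-identityˡ rest)
      where
      rest = ∏ λ v → arcFactor (edge G (suc u) (suc v)) (x (suc u) - x (suc v))

  Ψ′-isolated : ∀ {m′} → m ≡ suc m′ → ∀ x → Distinct x → Ψ′ G x ≡ 0ℚ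
  Ψ′-isolated refl x distinct = trans (∑-words-suc m _) (∑-zero λ {w} w∈ → inner (words-arrangement w∈))
    where
    open InsertionSums x distinct
    inner : ∀ {w} → Arrangement w → ∑[ v ← insertions zero (map suc w) ] 𝟙 (respects G v) * wt v ≡ 0ℚ
    inner {c ∷ ws} (u , _) = begin
      ∑[ v ← insertions zero (map suc (c ∷ ws)) ] 𝟙 (respects G v) * wt v
        ≡⟨ ∑-cong (λ {v} v∈ → cong (λ b → 𝟙 b * wt v) (respects-insertions G zero out in′ (map suc (c ∷ ws)) v∈)) ⟩
      ∑[ v ← insertions zero (map suc (c ∷ ws)) ] 𝟙 (respects G (map suc (c ∷ ws))) * wt v
        ≡⟨ ∑-*ˡ (𝟙 (respects G (map suc (c ∷ ws)))) (insertions zero (map suc (c ∷ ws))) wt ⟩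
      𝟙 (respects G (map suc (c ∷ ws))) * (∑[ v ← insertions zero (map suc (c ∷ ws)) ] wt v)
        ≡⟨ cong (𝟙 (respects G (map suc (c ∷ ws))) *_) (∑-insertions zero (suc c) (map suc ws) (unique-zero∷suc u)) ⟩
      𝟙 (respects G (map suc (c ∷ ws))) * 0ℚ
        ≡⟨ *-zeroʳ (𝟙 (respects G (map suc (c ∷ ws)))) ⟩
      0ℚ ∎
      where open ≡-Reasoning
    inner {[]} (_ , w∋) with () ← w∋ zero

module Leaf {m : ℕ} (G : Graph (suc m)) {u : Fin m} (0u : edge G zero (suc u) ≡ true)
            (only-0u : ∀ v → edge G zero v ≡ true → v ≡ suc u) (in′ : ∀ v → edge G v zero ≡ false) where

  private
    G′ = comap suc G
    D  = G ∖ (zero , suc u)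

    out-D : ∀ v → edge D zero v ≡ false
    out-D v with edge G zero v in 0v
    ... | false = ∧-zeroʳ _
    ... | true with only-0u v 0v
    ...   | refl = cong (λ b → not b ∧ true) (dec-true ((zero , suc u) ≟ₑ (zero , suc u)) refl)

    in-D : ∀ v → edge D v zero ≡ false
    in-D v = ∖-absent G (in′ v)

  Ψ′-leaf : ∀ x → Distinct x → Ψ′ G x ≡ Ψ′ G′ (x ∘ suc) * inv (x zero - x (suc u))
  Ψ′-leaf x distinct = trans (∑-words-suc m _)
                      (trans (∑-cong λ w∈ → inner (words-arrangement w∈))
                             (∑-*ʳ _ (words m) λ w → 𝟙 (respects G′ w) * wordTerm (x ∘ suc) w))
    where
    open InsertionSums x distinct
    inner : ∀ {w} → Arrangement w → ∑[ v ← insertions zero (map suc w) ] 𝟙 (respects G v) * wt v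
                                    ≡ 𝟙 (respects G′ w) * wordTerm (x ∘ suc) w * ι zero (suc u)
    inner {w} (uw , w∋) = begin
      ∑[ v ← L ] 𝟙 (respects G v) * wt v
        ≡⟨ ∑-cong split ⟩
      ∑[ v ← L ] 𝟙 (respects D (map suc w)) * (𝟙 (respects S v) * wt v)
        ≡⟨ ∑-*ˡ (𝟙 (respects D (map suc w))) L (λ v → 𝟙 (respects S v) * wt v) ⟩
      𝟙 (respects D (map suc w)) * (∑[ v ← L ] 𝟙 (respects S v) * wt v)
        ≡⟨ cong₂ _*_ (cong 𝟙 (respects-comap D suc w))
                     (∑-insertions-before zero (suc u) (map suc w) (unique-zero∷suc uw) (∈-map⁺ suc (w∋ u))) ⟩
      𝟙 (respects G′ w) * (wt (map suc w) * ι zero (suc u))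
        ≡⟨ cong (λ t → 𝟙 (respects G′ w) * (t * ι zero (suc u))) (wordTerm-map x suc w) ⟩
      𝟙 (respects G′ w) * (wordTerm (x ∘ suc) w * ι zero (suc u))
        ≡⟨ *-assoc (𝟙 (respects G′ w)) (wordTerm (x ∘ suc) w) (ι zero (suc u)) ⟨
      𝟙 (respects G′ w) * wordTerm (x ∘ suc) w * ι zero (suc u) ∎
      where
      open ≡-Reasoning
      L = insertions zero (map suc w)
      S = single (zero , suc u)
      split : ∀ {v} → v ∈ L → 𝟙 (respects G v) * wt v ≡ 𝟙 (respects D (map suc w)) * (𝟙 (respects S v) * wt v)
      split {v} v∈ = trans (cong (λ b → 𝟙 b * wt v)
                                 (trans (respects-∖ G 0u v)
                                        (cong (_∧ respects S v) (respects-insertions D zero out-D in-D (map suc w) v∈))))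
                           (trans (cong (_* wt v) (𝟙-∧ (respects D (map suc w)) (respects S v)))
                                  (*-assoc (𝟙 (respects D (map suc w))) (𝟙 (respects S v)) (wt v)))

  N′-leaf : ∀ x → Distinct x → N′ G x ≡ N′ G′ (x ∘ suc)
  N′-leaf x distinct = begin
    Ψ′ G x * edgeProd′ G x
      ≡⟨ cong₂ _*_ (Ψ′-leaf x distinct) (trans (edgeProd′-∖ x G 0u) (cong (d *_) (edgeProd′-isolated D out-D in-D x))) ⟩
    (Ψ′ G′ x′ * inv d) * (d * edgeProd′ G′ x′)
      ≡⟨ reorder (Ψ′ G′ x′) (inv d) d (edgeProd′ G′ x′) ⟩
    N′ G′ x′ * (d * inv d)
      ≡⟨ cong (N′ G′ x′ *_) (*-inv d (p≢q⇒p-q≢0 (zero≢suc ∘ distinct))) ⟩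
    N′ G′ x′ * 1ℚ
      ≡⟨ *-identityʳ _ ⟩
    N′ G′ x′ ∎
    where
    open ≡-Reasoning
    x′ = x ∘ suc
    d  = x zero - x (suc u)
    zero≢suc : zero ≢ suc u
    zero≢suc ()
    reorder : ∀ p i d e → (p * i) * (d * e) ≡ (p * e) * (d * i)
    reorder = solve 4 (λ p i d e → (p :* i) :* (d :* e) := (p :* e) :* (d :* i)) refl

  connected⇔ : Connected G ⇔ Connected G′
  connected⇔ = mk⇔ to from
    where
    collapse : Fin (suc m) → Fin m
    collapse zero    = u
    collapse (suc a) = a
    collapse-arc : ∀ {s t} → edge G s t ≡ true → Reach G′ (collapse s) (collapse t)
    collapse-arc {zero}  {t}     0t with only-0u t 0t
    ... | refl = here
    collapse-arc {suc a} {zero}  a0 = ⊥-elim (true≢false (trans (sym a0) (in′ (suc a))))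
    collapse-arc {suc a} {suc b} ab = arc ab
    to : Connected G → Connected G′
    to c a b = Reach-image collapse collapse-arc (c (suc a) (suc b))
    via-collapse : ∀ s → Reach G s (suc (collapse s))
    via-collapse zero    = arc 0u
    via-collapse (suc a) = here
    from : Connected G′ → Connected G
    from c s t = Reach-trans (via-collapse s)
                   (Reach-trans (Reach-image suc arc (c (collapse s) (collapse t))) (Reach-sym (via-collapse t)))

-- Forests

Forest : ∀ {n} → Graph n → Set
Forest G = ∀ {a b} → edge G a b ≡ true → ¬ Reach (G ∖ (a , b)) a b

module _ {n : ℕ} where

  ∖-mono : ∀ {G H : Graph n} e → H ⊆ G → H ∖ e ⊆ G ∖ e
  ∖-mono {G} {H} e H⊆G = mk⊆ λ uv → ∖-keeps G (∖-≢ H uv) (⊆-edge H⊆G (⊆-edge (∖-⊆ H e) uv))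

  ∖-∖-⊆ : ∀ (G : Graph n) e f → G ∖ e ∖ f ⊆ G ∖ f
  ∖-∖-⊆ G e f = ∖-mono f (∖-⊆ G e)

  ∪-∖-⊆ : ∀ (G : Graph n) e f → G ∪ e ∖ f ⊆ G ∖ f ∪ e
  ∪-∖-⊆ G e f = mk⊆ λ {u} {v} uv → case′ uv (∪-cases G {e} {u} {v} (⊆-edge (∖-⊆ (G ∪ e) f) uv))
    where
    case′ : ∀ {u v} → edge (G ∪ e ∖ f) u v ≡ true → (u , v) ≡ e ⊎ edge G u v ≡ true → edge (G ∖ f ∪ e) u v ≡ true
    case′ _  (inj₁ refl) = ∪-adds (G ∖ f) e
    case′ uv (inj₂ uv∈G) = ⊆-edge (∪-⊇ (G ∖ f) e) (∖-keeps G (∖-≢ (G ∪ e) uv) uv∈G)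

  ∪-∖-⊆-self : ∀ (G : Graph n) e → G ∪ e ∖ e ⊆ G
  ∪-∖-⊆-self G e = mk⊆ λ {u} {v} uv → case′ uv (∪-cases G {e} {u} {v} (⊆-edge (∖-⊆ (G ∪ e) e) uv))
    where
    case′ : ∀ {u v} → edge (G ∪ e ∖ e) u v ≡ true → (u , v) ≡ e ⊎ edge G u v ≡ true → edge G u v ≡ true
    case′ uv (inj₁ uv≡e) = ⊥-elim (∖-≢ (G ∪ e) uv uv≡e)
    case′ _  (inj₂ uv∈G) = uv∈G

  Connected-map : ∀ {G H : Graph n} → (∀ {a b} → edge G a b ≡ true → Reach H a b) → Connected G → Connected H
  Connected-map h c u v = Reach-map h (c u v)

  Reach-∪-via : ∀ {G H : Graph n} {s t} → G ⊆ H → Reach H s t → ∀ {a b} → Reach (G ∪ (s , t)) a b → Reach H a b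
  Reach-∪-via {G} {H} {s} {t} G⊆H st = Reach-map via
    where
    via : ∀ {u v} → edge (G ∪ (s , t)) u v ≡ true → Reach H u v
    via {u} {v} uv with ∪-cases G {s , t} {u} {v} uv
    ... | inj₁ refl = st
    ... | inj₂ uv′  = arc (⊆-edge G⊆H uv′)

  Reach-∪-avoid : ∀ {H : Graph n} {s t a} → ¬ Reach H a s → ¬ Reach H a t →
                  ∀ {b} → Reach (H ∪ (s , t)) a b → Reach H a b
  Reach-∪-avoid ¬as ¬at here = here
  Reach-∪-avoid {H} {s} {t} ¬as ¬at (fwd {u} {v} uv r) with ∪-cases H {s , t} {u} {v} uv
  ... | inj₁ refl = ⊥-elim (¬as here)
  ... | inj₂ uv′  = fwd uv′ (Reach-∪-avoid (¬as ∘ fwd uv′) (¬at ∘ fwd uv′) r)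
  Reach-∪-avoid {H} {s} {t} ¬as ¬at (bwd {u} {v} vu r) with ∪-cases H {s , t} {v} {u} vu
  ... | inj₁ refl = ⊥-elim (¬at here)
  ... | inj₂ vu′  = bwd vu′ (Reach-∪-avoid (¬as ∘ bwd vu′) (¬at ∘ bwd vu′) r)

module _ {n : ℕ} {F : Graph n} (forest : Forest F) where

  forest-⊆ : ∀ {H : Graph n} → H ⊆ F → Forest H
  forest-⊆ H⊆F ab r = forest (⊆-edge H⊆F ab) (Reach-⊆ (∖-mono _ H⊆F) r)

  forest-≢ : ∀ {a b} → edge F a b ≡ true → a ≢ b
  forest-≢ ab refl = forest ab here

  forest-loopless : ∀ a → edge F a a ≡ false
  forest-loopless a = ≢true⇒≡false λ aa → forest-≢ aa refl

  forest-bridge : ∀ {a b} → edge F a b ≡ true → ¬ Connected (F ∖ (a , b))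
  forest-bridge ab connected = forest ab (connected _ _)

  forest-antisym : ∀ {a b} → edge F a b ≡ true → edge F b a ≡ false
  forest-antisym ab = ≢true⇒≡false λ ba → forest ab (arc⁻ (∖-keeps F (forest-≢ ab ∘ sym ∘ cong proj₁) ba))

  forest-no-triangle : ∀ {o p q} → edge F o p ≡ true → edge F o q ≡ true → p ≢ q → edge F p q ≡ false
  forest-no-triangle op oq p≢q = ≢true⇒≡false λ pq →
    forest op (Reach-trans (arc (∖-keeps F (p≢q ∘ sym ∘ cong proj₂) oq))
                           (arc⁻ (∖-keeps F (forest-≢ op ∘ sym ∘ cong proj₁) pq)))

module Reverse {n : ℕ} {F : Graph n} (forest : Forest F) {w o : Fin n} (wo : edge F w o ≡ true) where

  reversed : Graph n
  reversed = F ∖ (w , o) ∪ (o , w)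

  reversed-forest : Forest reversed
  reversed-forest {c} {d} cd r with ∪-cases (F ∖ (w , o)) {o , w} {c} {d} cd
  ... | inj₁ refl = forest wo (Reach-sym (Reach-⊆ (∪-∖-⊆-self (F ∖ (w , o)) (o , w)) r))
  ... | inj₂ cd′  = forest (⊆-edge (∖-⊆ F (w , o)) cd′)
    (Reach-∪-via (∖-∖-⊆ F (w , o) (c , d)) (arc⁻ (∖-keeps F (∖-≢ F cd′ ∘ sym) wo))
                 (Reach-⊆ (∪-∖-⊆ (F ∖ (w , o)) (o , w) (c , d)) r))

  reversed-connected : Connected F ⇔ Connected reversed
  reversed-connected = mk⇔ (Connected-map to) (Connected-map from)
    where
    to : ∀ {a b} → edge F a b ≡ true → Reach reversed a b
    to {a} {b} ab with (a , b) ≟ₑ (w , o)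
    ... | yes refl = arc⁻ (∪-adds (F ∖ (w , o)) (o , w))
    ... | no  ab≢  = arc (⊆-edge (∪-⊇ (F ∖ (w , o)) (o , w)) (∖-keeps F ab≢ ab))
    from : ∀ {a b} → edge reversed a b ≡ true → Reach F a b
    from {a} {b} ab with ∪-cases (F ∖ (w , o)) {o , w} {a} {b} ab
    ... | inj₁ refl = arc⁻ wo
    ... | inj₂ ab′  = arc (⊆-edge (∖-⊆ F (w , o)) ab′)

module Fork {n : ℕ} {F : Graph n} (forest : Forest F) {o p q : Fin n}
            (op : edge F o p ≡ true) (oq : edge F o q ≡ true) (p≢q : p ≢ q) where

  exchanged : Graph n
  exchanged = F ∖ (o , q) ∪ (p , q)

  private
    op-kept : edge (F ∖ (o , q)) o p ≡ true
    op-kept = ∖-keeps F (p≢q ∘ cong proj₂) op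

  -- Without o → p, the component of o contains neither p nor q, so the new arc p → q does not help.
  exchanged-forest : Forest exchanged
  exchanged-forest {c} {d} cd r with ∪-cases (F ∖ (o , q)) {p , q} {c} {d} cd
  ... | inj₁ refl = forest oq (Reach-trans (arc op-kept) (Reach-⊆ (∪-∖-⊆-self (F ∖ (o , q)) (p , q)) r))
  ... | inj₂ cd′ with (c , d) ≟ₑ (o , p)
  ...   | yes refl = forest op (Reach-⊆ (∖-∖-⊆ F (o , q) (o , p))
                       (Reach-∪-avoid (forest op ∘ Reach-⊆ (∖-∖-⊆ F (o , q) (o , p)))
                                      (forest oq ∘ Reach-⊆ (∖-⊆ (F ∖ (o , q)) (o , p)))
                                      (Reach-⊆ (∪-∖-⊆ (F ∖ (o , q)) (p , q) (o , p)) r)))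
  ...   | no  cd≢op = forest (⊆-edge (∖-⊆ F (o , q)) cd′)
    (Reach-∪-via (∖-∖-⊆ F (o , q) (c , d))
                 (Reach-trans (arc⁻ (∖-keeps F (cd≢op ∘ sym) op)) (arc (∖-keeps F (∖-≢ F cd′ ∘ sym) oq)))
                 (Reach-⊆ (∪-∖-⊆ (F ∖ (o , q)) (p , q) (c , d)) r))

  exchanged-connected : Connected F ⇔ Connected exchanged
  exchanged-connected = mk⇔ (Connected-map to) (Connected-map from)
    where
    to : ∀ {a b} → edge F a b ≡ true → Reach exchanged a b
    to {a} {b} ab with (a , b) ≟ₑ (o , q)
    ... | yes refl = Reach-trans (arc (⊆-edge (∪-⊇ (F ∖ (o , q)) (p , q)) op-kept)) (arc (∪-adds (F ∖ (o , q)) (p , q)))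
    ... | no  ab≢  = arc (⊆-edge (∪-⊇ (F ∖ (o , q)) (p , q)) (∖-keeps F ab≢ ab))
    from : ∀ {a b} → edge exchanged a b ≡ true → Reach F a b
    from {a} {b} ab with ∪-cases (F ∖ (o , q)) {p , q} {a} {b} ab
    ... | inj₁ refl = Reach-trans (arc⁻ op) (arc oq)
    ... | inj₂ ab′  = arc (⊆-edge (∖-⊆ F (o , q)) ab′)

forest-comap-suc : ∀ {m} {F : Graph (suc m)} → Forest F → Forest (comap suc F)
forest-comap-suc {F = F} forest {a} {b} ab r = forest ab (Reach-image suc lift r)
  where
  lift : ∀ {u v} → edge (comap suc F ∖ (a , b)) u v ≡ true → Reach (F ∖ (suc a , suc b)) (suc u) (suc v)
  lift uv = arc (∖-keeps F (∖-≢ (comap suc F) uv ∘ suc-pair-injective) (⊆-edge (∖-⊆ (comap suc F) (a , b)) uv))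
    where
    suc-pair-injective : ∀ {u v} → (suc u , suc v) ≡ (suc a , suc b) → (u , v) ≡ (a , b)
    suc-pair-injective refl = refl

ConnectivityIndicator : ∀ {n} → Graph n → (Fin n → ℚ) → Set
ConnectivityIndicator F x = (Connected F → N′ F x ≡ 1ℚ) × (¬ Connected F → N′ F x ≡ 0ℚ)

indicator-transfer : ∀ {m n} {F : Graph n} {F′ : Graph m} {x x′} → Connected F ⇔ Connected F′ →
                     N′ F x ≡ N′ F′ x′ → ConnectivityIndicator F′ x′ → ConnectivityIndicator F x
indicator-transfer F⇔F′ N′≡ (conn , disc) =
  (λ c → trans N′≡ (conn (Equivalence.to F⇔F′ c))) , (λ ¬c → trans N′≡ (disc (¬c ∘ Equivalence.from F⇔F′)))

-- In-arcs count twice, so that reversing one (which may add an out-arc) lowers the weight.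
weight₀ : ∀ {m} → Graph (suc m) → ℕ
weight₀ G = count (edge G zero) ℕ.+ (count (λ v → edge G v zero) ℕ.+ count (λ v → edge G v zero))

module _ {m : ℕ} (G F : Graph (suc m)) where

  private
    out = λ (H : Graph (suc m)) → edge H zero
    in′ = λ (H : Graph (suc m)) v → edge H v zero

  weight₀-<-out : out G ⊆ᵇ out F → in′ G ⊆ᵇ in′ F → ∀ j → edge G zero j ≡ false → edge F zero j ≡ true →
                  weight₀ G < weight₀ F
  weight₀-<-out out⊆ in⊆ j G0j F0j =
    ℕₚ.+-mono-<-≤ (count-strict out⊆ j G0j F0j) (ℕₚ.+-mono-≤ (count-mono in⊆) (count-mono in⊆))

  weight₀-<-in : ∀ j → (∀ i → i ≢ j → edge G zero i ≡ true → edge F zero i ≡ true) →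
                 in′ G ⊆ᵇ in′ F → edge G j zero ≡ false → edge F j zero ≡ true → weight₀ G < weight₀ F
  weight₀-<-in j out⊆ in⊆ Gj0 Fj0 = begin-strict
    o′ ℕ.+ (i′ ℕ.+ i′)                ≤⟨ ℕₚ.+-monoˡ-≤ (i′ ℕ.+ i′) (count-≤-suc j out⊆) ⟩
    suc o ℕ.+ (i′ ℕ.+ i′)             <⟨ ℕₚ.n<1+n _ ⟩
    suc (suc o ℕ.+ (i′ ℕ.+ i′))       ≡⟨ shift o i′ ⟩
    o ℕ.+ (suc i′ ℕ.+ suc i′)         ≤⟨ ℕₚ.+-monoʳ-≤ o (ℕₚ.+-mono-≤ fewer fewer) ⟩
    o ℕ.+ (i ℕ.+ i)                   ∎
    where
    open ℕₚ.≤-Reasoning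
    o  = count (out F)
    o′ = count (out G)
    i  = count (in′ F)
    i′ = count (in′ G)
    fewer : suc i′ ≤ i
    fewer = count-strict in⊆ j Gj0 Fj0
    shift : ∀ o i → suc (suc o ℕ.+ (i ℕ.+ i)) ≡ o ℕ.+ (suc i ℕ.+ suc i)
    shift = ℕ-Solver.solve-∀

isolated-Reach : ∀ {n} {F : Graph n} {a} → (∀ v → edge F a v ≡ false) → (∀ v → edge F v a ≡ false) →
                 ∀ {b} → Reach F a b → a ≡ b
isolated-Reach out in′ here                  = refl
isolated-Reach out in′ (fwd {v = v} av _) = ⊥-elim (true≢false (trans (sym av) (out v)))
isolated-Reach out in′ (bwd {v = v} va _) = ⊥-elim (true≢false (trans (sym va) (in′ v)))

isolated-indicator : ∀ {m} (F : Graph (suc m)) → (∀ v → edge F zero v ≡ false) → (∀ v → edge F v zero ≡ false) →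
                     ∀ x → Distinct x → ConnectivityIndicator F x
isolated-indicator {zero} F out in′ x _ = (λ _ → N′≡1) , (λ ¬c → ⊥-elim (¬c λ { zero zero → here }))
  where
  N′≡1 : N′ F x ≡ 1ℚ
  N′≡1 rewrite out zero = refl
isolated-indicator {suc m} F out in′ x distinct =
  (λ c → ⊥-elim (zero≢one (isolated-Reach out in′ (c zero (suc zero))))) ,
  (λ _ → trans (cong (_* edgeProd′ F x) (Ψ′-isolated F out in′ refl x distinct)) (*-zeroˡ (edgeProd′ F x)))
  where
  zero≢one : zero ≢ suc (zero {m})
  zero≢one ()

ForestIndicator : ℕ → Set
ForestIndicator n = ∀ (F : Graph n) → Forest F → ∀ x → Distinct x → ConnectivityIndicator F x

module VertexZero {m : ℕ} (forest-indicatorₘ : ForestIndicator m) (F : Graph (suc m)) (forest : Forest F)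
                  (smaller : ∀ {F′ : Graph (suc m)} → weight₀ F′ < weight₀ F →
                             Forest F′ → ∀ x → Distinct x → ConnectivityIndicator F′ x)
                  (x : Fin (suc m) → ℚ) (distinct : Distinct x) where

  reverse-case : ∀ {w} → edge F w zero ≡ true → ConnectivityIndicator F x
  reverse-case {w} w0 =
    indicator-transfer reversed-connected N′-F≡
      (smaller weight-reversed reversed-forest x distinct)
    where
    open Reverse forest w0
    F₁ = F ∖ (w , zero)
    w≢0 : w ≢ zero
    w≢0 = forest-≢ forest w0
    weight-F₁ : weight₀ F₁ < weight₀ F
    weight-F₁ = weight₀-<-in F₁ F w (λ i _ → ⊆-edge (∖-⊆ F (w , zero)) {zero} {i})
                             (λ v → ⊆-edge (∖-⊆ F (w , zero)) {v} {zero}) (∖-removes F (w , zero)) w0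
    weight-reversed : weight₀ reversed < weight₀ F
    weight-reversed = weight₀-<-in reversed F w out⊆ in⊆ w0∉ w0
      where
      out⊆ : ∀ i → i ≢ w → edge reversed zero i ≡ true → edge F zero i ≡ true
      out⊆ i i≢w 0i with ∪-cases F₁ {zero , w} {zero} {i} 0i
      ... | inj₁ refl = ⊥-elim (i≢w refl)
      ... | inj₂ 0i′  = ⊆-edge (∖-⊆ F (w , zero)) 0i′
      in⊆ : ∀ v → edge reversed v zero ≡ true → edge F v zero ≡ true
      in⊆ v v0 with ∪-cases F₁ {zero , w} {v} {zero} v0
      ... | inj₁ refl = ⊥-elim (w≢0 refl)
      ... | inj₂ v0′  = ⊆-edge (∖-⊆ F (w , zero)) v0′
      w0∉ : edge reversed w zero ≡ false
      w0∉ = ≢true⇒≡false λ w0′ → case′ (∪-cases F₁ {zero , w} {w} {zero} w0′)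
        where
        case′ : (w , zero) ≡ (zero , w) ⊎ edge F₁ w zero ≡ true → ⊥
        case′ (inj₁ eq)  = w≢0 (cong proj₁ eq)
        case′ (inj₂ w0″) = true≢false (trans (sym w0″) (∖-removes F (w , zero)))
    N′-F₁≡0 : N′ F₁ x ≡ 0ℚ
    N′-F₁≡0 = proj₂ (smaller weight-F₁ (forest-⊆ forest (∖-⊆ F (w , zero))) x distinct) (forest-bridge forest w0)
    N′-F≡ : N′ F x ≡ N′ reversed x
    N′-F≡ = trans (N′-reverse x F w≢0 w0 (forest-antisym forest w0))
                  (trans (cong (λ t → (x w - x zero) * t + N′ reversed x) N′-F₁≡0) (lemma (x w - x zero) (N′ reversed x)))
      where
      lemma : ∀ d t → d * 0ℚ + t ≡ t
      lemma = solve 2 (λ d t → d :* con 0ℚ :+ t := t) refl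

  fork-case : (∀ v → edge F v zero ≡ false) → ∀ {p q} → edge F zero p ≡ true → edge F zero q ≡ true → p ≢ q →
              ConnectivityIndicator F x
  fork-case no-in {p} {q} 0p 0q p≢q =
    (λ c → collapse (proj₁ indicator₁ (Equivalence.to F₁.exchanged-connected c))
                    (proj₁ indicator₂ (Equivalence.to F₂.exchanged-connected c))) ,
    (λ ¬c → collapse (proj₂ indicator₁ (¬c ∘ Equivalence.from F₁.exchanged-connected))
                     (proj₂ indicator₂ (¬c ∘ Equivalence.from F₂.exchanged-connected)))
    where
    module F₁ = Fork forest 0p 0q p≢q
    module F₂ = Fork forest 0q 0p (p≢q ∘ sym)
    lighter : ∀ {p q} → edge F zero p ≡ true → edge F zero q ≡ true → weight₀ (F ∖ (zero , q) ∪ (p , q)) < weight₀ F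
    lighter {p} {q} 0p 0q = weight₀-<-out G F out⊆ in⊆ q 0q∉G 0q
      where
      G = F ∖ (zero , q) ∪ (p , q)
      arcs : ∀ {u v} → edge G u v ≡ true → (u , v) ≡ (p , q) ⊎ edge (F ∖ (zero , q)) u v ≡ true
      arcs {u} {v} = ∪-cases (F ∖ (zero , q)) {p , q} {u} {v}
      out⊆ : ∀ i → edge G zero i ≡ true → edge F zero i ≡ true
      out⊆ i 0i with arcs 0i
      ... | inj₁ eq  = ⊥-elim (forest-≢ forest 0p (cong proj₁ eq))
      ... | inj₂ 0i′ = ⊆-edge (∖-⊆ F (zero , q)) 0i′
      in⊆ : ∀ v → edge G v zero ≡ true → edge F v zero ≡ true
      in⊆ v v0 with arcs v0
      ... | inj₁ eq  = ⊥-elim (forest-≢ forest 0q (cong proj₂ eq))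
      ... | inj₂ v0′ = ⊆-edge (∖-⊆ F (zero , q)) v0′
      0q∉G : edge G zero q ≡ false
      0q∉G = ≢true⇒≡false λ 0q′ → case′ (arcs 0q′)
        where
        case′ : (zero , q) ≡ (p , q) ⊎ edge (F ∖ (zero , q)) zero q ≡ true → ⊥
        case′ (inj₁ eq)  = forest-≢ forest 0p (cong proj₁ eq)
        case′ (inj₂ 0q″) = true≢false (trans (sym 0q″) (∖-removes F (zero , q)))
    indicator₁ = smaller (lighter 0p 0q) F₁.exchanged-forest x distinct
    indicator₂ = smaller (lighter 0q 0p) F₂.exchanged-forest x distinct
    collapse : ∀ {t} → N′ F₁.exchanged x ≡ t → N′ F₂.exchanged x ≡ t → N′ F x ≡ t
    collapse {t} N′₁ N′₂ = *-cancelˡ (N′ F x) t (p≢q⇒p-q≢0 (p≢q ∘ distinct)) (begin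
      (x p - x q) * N′ F x
        ≡⟨ N′-fork x F p≢q 0p 0q (forest-no-triangle forest 0p 0q p≢q) (forest-no-triangle forest 0q 0p (p≢q ∘ sym)) ⟩
      (x zero - x q) * N′ F₁.exchanged x - (x zero - x p) * N′ F₂.exchanged x
        ≡⟨ cong₂ (λ s r → (x zero - x q) * s - (x zero - x p) * r) N′₁ N′₂ ⟩
      (x zero - x q) * t - (x zero - x p) * t
        ≡⟨ telescope (x zero) (x p) (x q) t ⟩
      (x p - x q) * t ∎)
      where
      open ≡-Reasoning
      telescope : ∀ o p q t → (o - q) * t - (o - p) * t ≡ (p - q) * t
      telescope = solve 4 (λ o p q t → (o :- q) :* t :- (o :- p) :* t := (p :- q) :* t) refl

  leaf-case : (∀ v → edge F v zero ≡ false) → ∀ {u} → edge F zero (suc u) ≡ true →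
              (∀ v → edge F zero v ≡ true → v ≡ suc u) → ConnectivityIndicator F x
  leaf-case no-in 0u only =
    indicator-transfer (Leaf.connected⇔ F 0u only no-in) (Leaf.N′-leaf F 0u only no-in x distinct)
      (forest-indicatorₘ (comap suc F) (forest-comap-suc forest) (x ∘ suc) (suc-injective ∘ distinct))

  indicator : ConnectivityIndicator F x
  indicator with Finₚ.any? (λ v → edge F v zero Boolₚ.≟ true)
  ... | yes (w , w0) = reverse-case w0
  ... | no  ¬in with Finₚ.any? (λ v → edge F zero v Boolₚ.≟ true)
  ...   | no ¬out = isolated-indicator F (none ¬out) no-in x distinct
    where
    none : ∀ {f : Fin (suc m) → Bool} → ¬ (∃ λ v → f v ≡ true) → ∀ v → f v ≡ false
    none ¬any v = ≢true⇒≡false (¬any ∘ (v ,_))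
    no-in = none ¬in
  ...   | yes (zero , loop) = ⊥-elim (true≢false (trans (sym loop) (forest-loopless forest zero)))
  ...   | yes (suc u , 0u) with Finₚ.any? (λ v → (edge F zero v Boolₚ.≟ true) ×-dec ¬? (v Finₚ.≟ suc u))
  ...     | yes (v , 0v , v≢u) = fork-case no-in 0u 0v (v≢u ∘ sym)
    where
    no-in = λ v → ≢true⇒≡false (¬in ∘ (v ,_))
  ...     | no ¬other = leaf-case no-in 0u only
    where
    no-in = λ v → ≢true⇒≡false (¬in ∘ (v ,_))
    only : ∀ v → edge F zero v ≡ true → v ≡ suc u
    only v 0v with v Finₚ.≟ suc u
    ... | yes v≡u = v≡u
    ... | no  v≢u = ⊥-elim (¬other (v , 0v , v≢u))

forest-indicator : ∀ n → ForestIndicator n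
forest-indicator zero    F _ x _ = (λ _ → refl) , (λ ¬c → ⊥-elim (¬c λ ()))
forest-indicator (suc m) =
  WF.All.wfRec (On.wellFounded weight₀ <-wellFounded) 0ℓ
    (λ F → Forest F → ∀ x → Distinct x → ConnectivityIndicator F x)
    (λ F smaller forest x distinct → VertexZero.indicator (forest-indicator m) F forest smaller x distinct)

forest-polyVanish : ∀ {n} (F : Graph n) → Forest F → PolyVanish F (N′ F)
forest-polyVanish F forest with Connected? F
... | yes c  = con 1ℚ , (λ x d → proj₁ (forest-indicator _ F forest x d) c) , (λ ¬c → ⊥-elim (¬c c))
... | no  ¬c = zero-polyVanish λ x d → proj₂ (forest-indicator _ F forest x d) ¬c

N′-polyVanish : ∀ {n} (G : Graph n) → PolyVanish G (N′ G)
N′-polyVanish = WF.All.wfRec (On.wellFounded edgeCount <-wellFounded) 0ℓ (λ G → PolyVanish G (N′ G)) by-cases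
  where
  by-cases : ∀ G → (∀ {H} → edgeCount H < edgeCount G → PolyVanish H (N′ H)) → PolyVanish G (N′ G)
  by-cases G smaller with Finₚ.any? (λ a → edge G a a Boolₚ.≟ true)
  ... | yes (a , aa) = zero-polyVanish λ x _ → trans (cong (_* edgeProd′ G x) (Ψ′-loop G aa x)) (*-zeroˡ (edgeProd′ G x))
  ... | no ¬loop with Finₚ.any? (λ a → Finₚ.any? λ b → (edge G a b Boolₚ.≟ true) ×-dec Reach? (G ∖ (a , b)) a b)
  ...   | yes (a , b , ab , r) = Cycle.N′-polyVanish G loopless ab (proj₂ (Reach⇒SimplePath r)) (λ H → smaller)
    where
    loopless : ∀ v → edge G v v ≡ false
    loopless v = ≢true⇒≡false (¬loop ∘ (v ,_))
  ...   | no ¬cycle = forest-polyVanish G λ {a} {b} ab r → ¬cycle (a , b , ab , r)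

mainTheorem3 : ∀ {n : ℕ} (G : Graph n) →
    (∃[ P ] ∀ (x : Fin n → ℚ) → Injective _≡_ _≡_ x → N G x ≡ eval P x)
    × (¬ Connected G → ∀ (x : Fin n → ℚ) → Injective _≡_ _≡_ x → N G x ≡ 0ℚ)
mainTheorem3 G with N′-polyVanish G
... | P , N′≡P , N′≡0 =
  (P , λ x d → trans (N≡N′ G x) (N′≡P x d)) , λ ¬c x d → trans (N≡N′ G x) (N′≡0 ¬c x d)
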